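{- Let $P$ be a finite poset and $k$ a commutative ring. The following are equivalent: (i) $\mathrm{Pot}(P,k)=\mathrm{Der}(P,k)$; (ii) $E(P)-\mathrm{rank}_k(\mathcal{M}_P)=V(P)-C(P)$.
   Context: A function $f$ on pairs $(x,y)$ with $x\le y$ in $P$, valued in $k$, is transitive if $f(x,z)=f(x,y)+f(y,z)$ whenever $x\le y\le z$; it is potential if there is $\varphi:P\to k$ with $f(x,y)=\varphi(y)-\varphi(x)$ for all $x\le y$. $\mathrm{Der}(P,k)$ and $\mathrm{Pot}(P,k)$ denote the $k$-modules of transitive and of potential functions respectively (so $\mathrm{Pot}(P,k)\subseteq\mathrm{Der}(P,k)$). $V(P)$ and $E(P)$ denote the number of vertices and edges of the Hasse diagram of $P$, and $C(P)$ the number of connected components of $P$ (of its Hasse diagram as an undirected graph). A pair of tuples $(x_0,\dots,x_r)$, $(y_0,\dots,y_s)$ of distinct elements is a parallel path if $x_0=y_0$, $x_r=y_s$, $x_i<x_{i+1}$ and $y_j<y_{j+1}$ for all $i,j$; its consistency relation is $\sum_{i=0}^{r-1}f(x_i,x_{i+1})-\sum_{j=0}^{s-1}f(y_j,y_{j+1})=0$. $\mathcal{M}_P$ is the matrix whose columns are indexed by the edges of the Hasse diagram of $P$ and whose rows are the consistency relations (coefficient vectors) of all parallel paths built from Hasse diagram edges (covering relations); $\mathrm{rank}_k$ is its rank over $k$. -}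

module Defs where

open import Level using (Level; 0ℓ)
open import Data.Nat as ℕ using (ℕ)
open import Data.Bool using (if_then_else_)
open import Data.Fin using (Fin; zero; suc; toℕ; punchIn)
open import Data.Fin.Properties using (_≟_; all?)
open import Data.Product using (Σ; Σ-syntax; ∃; _×_; _,_; proj₁; proj₂; uncurry)
open import Data.List using (List; length; filter; cartesianProduct; allFin)
open import Relation.Binary using (Rel; Decidable; IsPartialOrder)
open import Relation.Binary.PropositionalEquality using (_≡_; _≢_)
open import Relation.Nullary using (¬_; Dec; does)
open import Relation.Nullary.Decidable using (¬?; _×-dec_)
open import Relation.Binary.Construct.Closure.Equivalence using (EqClosure)
open import Algebra.Bundles using (CommutativeRing)

record FinitePoset : Set₁ where
  field
    size           : ℕ
    _≼_            : Rel (Fin size) 0ℓ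
    isPartialOrder : IsPartialOrder _≡_ _≼_
    _≼?_           : Decidable _≼_

  _≺_ : Rel (Fin size) 0ℓ
  x ≺ y = x ≼ y × x ≢ y

  _≺?_ : Decidable _≺_
  x ≺? y = (x ≼? y) ×-dec ¬? (x ≟ y)

  _⋖_ : Rel (Fin size) 0ℓ
  x ⋖ y = x ≺ y × (∀ z → ¬ (x ≺ z × z ≺ y))

  _⋖?_ : Decidable _⋖_
  x ⋖? y = (x ≺? y) ×-dec all? (λ z → ¬? ((x ≺? z) ×-dec (z ≺? y)))

  V : ℕ
  V = size

  E : ℕ
  E = length (filter (λ p → proj₁ p ⋖? proj₂ p)
                     (cartesianProduct (allFin size) (allFin size)))

  Connected : Rel (Fin size) 0ℓ
  Connected = EqClosure _⋖_

  Edge : Set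
  Edge = Σ[ a ∈ Fin size ] Σ[ b ∈ Fin size ] (a ⋖ b)

  data HPath : Fin size → Fin size → Set where
    []  : ∀ {x} → HPath x x
    _∷_ : ∀ {x z y} → x ⋖ z → HPath z y → HPath x y

  ParallelPath : Set
  ParallelPath = Σ[ x ∈ Fin size ] Σ[ y ∈ Fin size ] (HPath x y × HPath x y)

module _ {c ℓ} (k : CommutativeRing c ℓ) where
  open CommutativeRing k using (Carrier; _≈_; _+_; _*_; -_; 0#; 1#)

  _−_ : Carrier → Carrier → Carrier
  x − y = x + (- y)

  ∑ : ∀ {t} → (Fin t → Carrier) → Carrier
  ∑ {ℕ.zero}  f = 0#
  ∑ {ℕ.suc t} f = f zero + ∑ (λ i → f (suc i))

  sgn : ℕ → Carrier
  sgn ℕ.zero    = 1#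
  sgn (ℕ.suc m) = - sgn m

  det : ∀ {t} → (Fin t → Fin t → Carrier) → Carrier
  det {ℕ.zero}  A = 1#
  det {ℕ.suc t} A =
    ∑ (λ j → sgn (toℕ j)
             * (A zero j * det (λ i l → A (suc i) (punchIn j l))))

  MinorAnnZero : {Row Col : Set} → (Row → Col → Carrier) → ℕ → Set (c Level.⊔ ℓ)
  MinorAnnZero {Row} {Col} M t =
    ∀ r → (∀ (ρ : Fin t → Row) (γ : Fin t → Col) →
             r * det (λ i j → M (ρ i) (γ j)) ≈ 0#)
        → r ≈ 0#

  -- rank over k (McCoy rank): largest t with Ann(I_t(M)) = 0
  IsRank : {Row Col : Set} → (Row → Col → Carrier) → ℕ → Set (c Level.⊔ ℓ)
  IsRank M ρ = MinorAnnZero M ρ × (∀ t → MinorAnnZero M t → t ℕ.≤ ρ)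

  module _ (P : FinitePoset) where
    open FinitePoset P

    -- functions on pairs x ≤ y (represented by functions on all pairs,
    -- only the values on comparable pairs x ≼ y matter)
    IsTransitive : (Fin size → Fin size → Carrier) → Set ℓ
    IsTransitive f = ∀ x y z → x ≼ y → y ≼ z → f x z ≈ f x y + f y z

    IsPotential : (Fin size → Fin size → Carrier) → Set (c Level.⊔ ℓ)
    IsPotential f = ∃ λ (φ : Fin size → Carrier) → ∀ x y → x ≼ y → f x y ≈ φ y − φ x

    PotEqDer : Set (c Level.⊔ ℓ)
    PotEqDer = (∀ f → IsPotential f → IsTransitive f)
             × (∀ f → IsTransitive f → IsPotential f)

    coeff : ∀ {x y} → HPath x y → Fin size → Fin size → Carrier
    coeff []                    a b = 0#
    coeff (_∷_ {x} {z} _ p) a b =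
      (if does (x ≟ a) then (if does (z ≟ b) then 1# else 0#) else 0#) + coeff p a b

    -- the matrix M_P: rows = consistency relations of parallel paths,
    -- columns = Hasse diagram edges
    𝓜 : ParallelPath → Edge → Carrier
    𝓜 (x , y , p , q) (a , b , _) = coeff p a b − coeff q a b

{-# OPTIONS --safe #-}

-- Running Kruskal's procedure on the covering pairs splits the Hasse diagram into a spanning
-- forest T with |T| = V − C edges and the m = E − |T| remaining edges N.  Every function on edges
-- agrees on T with the coboundary of a potential.  Subtracting it shows, first, that each column of
-- 𝓜 is a k-linear combination of the N-columns, and second, that Pot = Der exactly when the
-- submatrix A of 𝓜 formed by the N-columns has trivial kernel.  By McCoy's theorem (Laplace
-- expansion in one direction, Cramer's rule in the other) A has trivial kernel iff its m×m minors
-- have zero annihilator; as the columns of 𝓜 and of A span the same module, this is the same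
-- condition on 𝓜, and together with rank 𝓜 ≤ m (which needs 1 ≠ 0) it says rank 𝓜 = m.

module Submission where

open import Level using (Level; _⊔_)
open import Data.Nat as ℕ using (ℕ; zero; suc; z≤n; s≤s)
import Data.Nat.Properties as ℕ
open import Data.Bool using (if_then_else_)
open import Data.Fin using (Fin; zero; suc; toℕ; punchIn; punchOut; fromℕ<)
open import Data.Fin.Properties
  using (_≟_; all?; any?; ¬∀⟶∃¬; pigeonhole; injective⇒≤; cantor-schröder-bernstein; suc-injective; toℕ-injective;
         toℕ<n; toℕ-fromℕ<; <⇒≢; punchInᵢ≢i; punchIn-injective; punchIn-punchOut; punchOut-injective)
open import Data.Vec.Functional using (Vector)
open import Data.Product as Product using (∃; ∃₂; _,_; proj₁; proj₂; _×_)
open import Data.Sum as Sum using (_⊎_; inj₁; inj₂)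
open import Data.Empty using (⊥-elim)
open import Data.List using (List; []; _∷_; foldr; length; lookup; filter; cartesianProduct; allFin)
open import Data.List.Membership.Propositional using (_∈_; _∉_)
open import Data.List.Membership.Propositional.Properties using (∈-filter⁺; ∈-cartesianProduct⁺; ∈-allFin; ∈-lookup)
open import Data.List.Relation.Unary.Any as Any using (here; there)
open import Data.List.Relation.Unary.Any.Properties using (lookup-index)
open import Data.List.Relation.Unary.All as All using ()
open import Data.List.Relation.Unary.All.Properties using (all-filter)
open import Data.List.Relation.Unary.AllPairs using ([]; _∷_)
open import Data.List.Relation.Unary.Unique.Propositional using (Unique)
import Data.List.Relation.Unary.Unique.Propositional.Properties as Unique
open import Function using (_∘_; id; _⟨_⟩_; _⇔_; mk⇔; Equivalence; Surjective)
open import Function.Properties.Equivalence using () renaming (trans to ⇔-trans; sym to ⇔-sym)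
open import Relation.Nullary using (¬_; Dec; yes; no; does)
open import Relation.Nullary.Decidable using (_×-dec_)
open import Relation.Unary using (Pred; Decidable; _⊆_)
open import Relation.Binary using (IsPartialOrder)
open import Relation.Binary.Definitions using (tri<; tri≈; tri>)
open import Relation.Binary.PropositionalEquality as ≡ using (_≡_; _≢_)
import Relation.Binary.Construct.Closure.Equivalence as EqClosure
open EqClosure using (EqClosure)
open import Algebra.Bundles using (CommutativeRing)
open import Defs hiding (det; sgn; ∑; _−_)
import Defs

punchIn-adjacent : ∀ {n} {a b : Fin (suc n)} → toℕ b ≡ suc (toℕ a) → ∀ k →
                   punchIn a k ≡ punchIn b k ⊎ (punchIn a k ≡ b × punchIn b k ≡ a)
punchIn-adjacent {a = zero}  {suc zero} _     zero    = inj₂ (≡.refl , ≡.refl)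
punchIn-adjacent {a = zero}  {suc zero} _     (suc k) = inj₁ ≡.refl
punchIn-adjacent {a = suc a} {suc b}    _     zero    = inj₁ ≡.refl
punchIn-adjacent {a = suc a} {suc b}    b≡a+1 (suc k) =
  Sum.map (≡.cong suc) (Product.map (≡.cong suc) (≡.cong suc)) (punchIn-adjacent (ℕ.suc-injective b≡a+1) k)

punchOut-adjacent : ∀ {n} {j a b : Fin (suc n)} (j≢a : j ≢ a) (j≢b : j ≢ b) → toℕ b ≡ suc (toℕ a) →
                    toℕ (punchOut j≢b) ≡ suc (toℕ (punchOut j≢a))
punchOut-adjacent {j = zero}                  {zero}  j≢a _   _     = ⊥-elim (j≢a ≡.refl)
punchOut-adjacent {j = zero}                  {suc a} {suc b} _   _   b≡a+1 = ℕ.suc-injective b≡a+1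
punchOut-adjacent {j = suc zero}              {zero}  {suc zero} _   j≢b _ = ⊥-elim (j≢b ≡.refl)
punchOut-adjacent {suc (suc n)} {suc (suc j)} {zero}  {suc zero} _   _   _ = ≡.refl
punchOut-adjacent {suc n}       {suc j}       {suc a} {suc b} j≢a j≢b b≡a+1 =
  ≡.cong suc (punchOut-adjacent (j≢a ∘ ≡.cong suc) (j≢b ∘ ≡.cong suc) (ℕ.suc-injective b≡a+1))

adjacent⇒≢ : ∀ {n} {a b : Fin n} → toℕ b ≡ suc (toℕ a) → a ≢ b
adjacent⇒≢ b≡a+1 a≡b = ℕ.1+n≢n (≡.sym (≡.trans (≡.cong toℕ a≡b) b≡a+1))

surjective-or-missing : ∀ {m n} (f : Fin m → Fin n) → (∀ c → ∃ λ l → f l ≡ c) ⊎ (∃ λ c → ∀ l → f l ≢ c)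
surjective-or-missing {n = n} f with all? (λ c → any? (λ l → f l ≟ c))
... | yes surjective = inj₁ surjective
... | no ¬surjective with ¬∀⟶∃¬ n _ (λ c → any? (λ l → f l ≟ c)) ¬surjective
...   | c , ¬hit = inj₂ (c , λ l fl≡c → ¬hit (l , fl≡c))

missing-value : ∀ {t m} (γ : Fin t → Fin m) → t ℕ.< m → ∃ λ c → ∀ l → γ l ≢ c
missing-value γ t<m with surjective-or-missing γ
... | inj₂ missing    = missing
... | inj₁ surjective = ⊥-elim (ℕ.<⇒≱ t<m (injective⇒≤ {f = proj₁ ∘ surjective} section-injective))
  where
  section-injective : ∀ {a b} → proj₁ (surjective a) ≡ proj₁ (surjective b) → a ≡ b
  section-injective {a} {b} eq =
    ≡.trans (≡.sym (proj₂ (surjective a))) (≡.trans (≡.cong γ eq) (proj₂ (surjective b)))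

surjective-or-collision : ∀ {m} (σ : Fin m → Fin m) →
                          (∀ c → ∃ λ l → σ l ≡ c) ⊎ (∃₂ λ i j → i ≢ j × σ i ≡ σ j)
surjective-or-collision σ with surjective-or-missing σ
... | inj₁ surjective = inj₁ surjective
surjective-or-collision {suc m} σ | inj₂ (c , missed)
  with pigeonhole (ℕ.n<1+n m) (λ l → punchOut (missed l ∘ ≡.sym))
... | i , j , i<j , eq = inj₂ (i , j , <⇒≢ i<j , punchOut-injective (missed i ∘ ≡.sym) (missed j ∘ ≡.sym) eq)

module RingDifferences {c ℓ} (R : CommutativeRing c ℓ) where

  open CommutativeRing R
  open import Algebra.Properties.Ring ring using (-‿+-comm)
  open import Algebra.Properties.CommutativeSemigroup +-commutativeSemigroup using (interchange)
  open import Relation.Binary.Reasoning.Setoid setoid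

  +-minus-telescope : ∀ x y z → (x - y) + (y - z) ≈ x - z
  +-minus-telescope x y z = begin
    (x - y) + (y - z)     ≈⟨ +-assoc x (- y) (y - z) ⟩
    x + (- y + (y - z))   ≈⟨ +-congˡ (+-assoc (- y) y (- z)) ⟨
    x + ((- y + y) - z)   ≈⟨ +-congˡ (+-congʳ (-‿inverseˡ y)) ⟩
    x + (0# - z)          ≈⟨ +-congˡ (+-identityˡ (- z)) ⟩
    x - z                 ∎

  [x+z]-[y+z]≈x-y : ∀ x y z → (x + z) - (y + z) ≈ x - y
  [x+z]-[y+z]≈x-y x y z = begin
    (x + z) - (y + z)        ≈⟨ +-congˡ (-‿+-comm y z) ⟨
    (x + z) + (- y + - z)    ≈⟨ interchange x z (- y) (- z) ⟩
    (x - y) + (z - z)        ≈⟨ +-congˡ (-‿inverseʳ z) ⟩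
    (x - y) + 0#             ≈⟨ +-identityʳ (x - y) ⟩
    x - y                    ∎

module LinearAlgebra {c ℓ} (R : CommutativeRing c ℓ) where

  open CommutativeRing R hiding (zero)
  open import Algebra.Properties.Ring ring using (-1*x≈-x; -‿distribˡ-*)
  open import Algebra.Properties.Semiring.Sum semiring public
    using (sum; sum-cong-≋; ∑-distrib-+; ∑-comm; *-distribˡ-sum; *-distribʳ-sum; sum-remove; sum-replicate-zero)
  open import Algebra.Properties.CommutativeSemigroup *-commutativeSemigroup using (x∙yz≈y∙xz)
  open import Relation.Binary.Reasoning.Setoid setoid

  sum-zero : ∀ {t} {f : Vector Carrier t} → (∀ i → f i ≈ 0#) → sum f ≈ 0#
  sum-zero {t} f≈0 = trans (sum-cong-≋ f≈0) (sum-replicate-zero t)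

  sum-delta : ∀ {t} (f : Vector Carrier t) j → (∀ i → i ≢ j → f i ≈ 0#) → sum f ≈ f j
  sum-delta {suc t} f j others = begin
    sum f                                ≈⟨ sum-remove f ⟩
    f j + sum (λ i → f (punchIn j i))    ≈⟨ +-congˡ (sum-zero (λ i → others _ (punchInᵢ≢i j i))) ⟩
    f j + 0#                             ≈⟨ +-identityʳ (f j) ⟩
    f j                                  ∎

  -‿sum : ∀ {t} (f : Vector Carrier t) → - sum f ≈ sum (λ i → - f i)
  -‿sum f = begin
    - sum f                         ≈⟨ -1*x≈-x (sum f) ⟨
    - 1# * sum f                    ≈⟨ *-distribˡ-sum (- 1#) f ⟩
    sum (λ i → - 1# * f i)          ≈⟨ sum-cong-≋ (λ i → -1*x≈-x (f i)) ⟩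
    sum (λ i → - f i)               ∎

  ∑-distrib-− : ∀ {t} (f g : Vector Carrier t) → sum (λ i → f i - g i) ≈ sum f - sum g
  ∑-distrib-− f g = trans (∑-distrib-+ f (λ i → - g i)) (+-congˡ (sym (-‿sum g)))

  ∑≡sum : ∀ {t} (f : Vector Carrier t) → Defs.∑ R f ≡ sum f
  ∑≡sum {zero}  f = ≡.refl
  ∑≡sum {suc t} f = ≡.cong (f zero +_) (∑≡sum (f ∘ suc))

  Matrix : ℕ → Set c
  Matrix t = Fin t → Fin t → Carrier

  det : ∀ {t} → Matrix t → Carrier
  det = Defs.det R

  sgn : ℕ → Carrier
  sgn = Defs.sgn R

  minor : ∀ {t} → Matrix (suc t) → Fin (suc t) → Matrix t
  minor A j i k = A (suc i) (punchIn j k)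

  det-expand : ∀ {t} (A : Matrix (suc t)) → det A ≈ sum (λ j → sgn (toℕ j) * (A zero j * det (minor A j)))
  det-expand {t} A = reflexive (∑≡sum {suc t} (λ j → sgn (toℕ j) * (A zero j * det (minor A j))))

  det-cong : ∀ {t} {A B : Matrix t} → (∀ i j → A i j ≈ B i j) → det A ≈ det B
  det-cong {zero}  A≈B = refl
  det-cong {suc t} {A} {B} A≈B = trans (det-expand A) (trans (sum-cong-≋ entries) (sym (det-expand B)))
    where
    entries = λ j → *-congˡ {sgn (toℕ j)} (*-cong (A≈B zero j) (det-cong (λ i k → A≈B (suc i) (punchIn j k))))

  IsLinearForm : ∀ {t} → (Vector Carrier t → Carrier) → Set (c ⊔ ℓ)
  IsLinearForm {t} G = ∃ λ (coefficient : Vector Carrier t) → ∀ v → G v ≈ sum (λ i → v i * coefficient i)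

  module _ {t} {G : Vector Carrier t → Carrier} (linear : IsLinearForm G) where

    private
      coefficient = proj₁ linear
      G≈ = proj₂ linear

    linearForm-zero : ∀ {v} → (∀ i → v i ≈ 0#) → G v ≈ 0#
    linearForm-zero {v} v≈0 = trans (G≈ v) (sum-zero (λ i → trans (*-congʳ (v≈0 i)) (zeroˡ _)))

    linearForm-+ : ∀ v w → G (λ i → v i + w i) ≈ G v + G w
    linearForm-+ v w = begin
      G (λ i → v i + w i)
        ≈⟨ G≈ _ ⟩
      sum (λ i → (v i + w i) * coefficient i)
        ≈⟨ sum-cong-≋ (λ i → distribʳ (coefficient i) (v i) (w i)) ⟩
      sum (λ i → v i * coefficient i + w i * coefficient i)
        ≈⟨ ∑-distrib-+ (λ i → v i * coefficient i) (λ i → w i * coefficient i) ⟩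
      sum (λ i → v i * coefficient i) + sum (λ i → w i * coefficient i)
        ≈⟨ +-cong (G≈ v) (G≈ w) ⟨
      G v + G w ∎

    linearForm-combination : ∀ {s} (w : Vector Carrier s) (V : Fin s → Vector Carrier t) →
                             G (λ i → sum (λ k → w k * V k i)) ≈ sum (λ k → w k * G (V k))
    linearForm-combination w V = begin
      G (λ i → sum (λ k → w k * V k i))
        ≈⟨ G≈ _ ⟩
      sum (λ i → sum (λ k → w k * V k i) * coefficient i)
        ≈⟨ sum-cong-≋ (λ i → *-distribʳ-sum (coefficient i) (λ k → w k * V k i)) ⟩
      sum (λ i → sum (λ k → w k * V k i * coefficient i))
        ≈⟨ ∑-comm (λ i k → w k * V k i * coefficient i) ⟩
      sum (λ k → sum (λ i → w k * V k i * coefficient i))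
        ≈⟨ sum-cong-≋ (λ k → sum-cong-≋ (λ i → *-assoc (w k) (V k i) (coefficient i))) ⟩
      sum (λ k → sum (λ i → w k * (V k i * coefficient i)))
        ≈⟨ sum-cong-≋ (λ k → *-distribˡ-sum (w k) (λ i → V k i * coefficient i)) ⟨
      sum (λ k → w k * sum (λ i → V k i * coefficient i))
        ≈⟨ sum-cong-≋ (λ k → *-congˡ (G≈ (V k))) ⟨
      sum (λ k → w k * G (V k)) ∎

  isLinearForm-resp : ∀ {t} {F G : Vector Carrier t → Carrier} → (∀ v → F v ≈ G v) → IsLinearForm G → IsLinearForm F
  isLinearForm-resp F≈G (coefficient , G≈) = coefficient , λ v → trans (F≈G v) (G≈ v)

  isLinearForm-sum : ∀ {t s} {F : Fin s → Vector Carrier t → Carrier} → (∀ j → IsLinearForm (F j)) →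
                   IsLinearForm (λ v → sum (λ j → F j v))
  isLinearForm-sum {F = F} linear = (λ i → sum (λ j → proj₁ (linear j) i)) , λ v → begin
    sum (λ j → F j v)
      ≈⟨ sum-cong-≋ (λ j → proj₂ (linear j) v) ⟩
    sum (λ j → sum (λ i → v i * proj₁ (linear j) i))
      ≈⟨ ∑-comm (λ j i → v i * proj₁ (linear j) i) ⟩
    sum (λ i → sum (λ j → v i * proj₁ (linear j) i))
      ≈⟨ sum-cong-≋ (λ i → *-distribˡ-sum (v i) (λ j → proj₁ (linear j) i)) ⟨
    sum (λ i → v i * sum (λ j → proj₁ (linear j) i)) ∎

  isLinearForm-scale : ∀ {t} {F : Vector Carrier t → Carrier} a → IsLinearForm F → IsLinearForm (λ v → a * F v)
  isLinearForm-scale {F = F} a (coefficient , F≈) = (λ i → a * coefficient i) , λ v → begin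
    a * F v                                     ≈⟨ *-congˡ (F≈ v) ⟩
    a * sum (λ i → v i * coefficient i)         ≈⟨ *-distribˡ-sum a (λ i → v i * coefficient i) ⟩
    sum (λ i → a * (v i * coefficient i))       ≈⟨ sum-cong-≋ (λ i → x∙yz≈y∙xz a (v i) _) ⟩
    sum (λ i → v i * (a * coefficient i))       ∎

  isLinearForm-head : ∀ {t} d → IsLinearForm {suc t} (λ v → v zero * d)
  isLinearForm-head d = coefficient , λ v →
    sym (trans (+-congˡ (sum-zero {f = λ i → v (suc i) * 0#} (λ i → zeroʳ _))) (+-identityʳ _))
    where
    coefficient : Vector Carrier _
    coefficient zero    = d
    coefficient (suc _) = 0#

  isLinearForm-tail : ∀ {t} {G : Vector Carrier t → Carrier} → IsLinearForm G → IsLinearForm {suc t} (λ v → G (v ∘ suc))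
  isLinearForm-tail (coefficient , G≈) = coefficient′ , λ v →
    trans (G≈ _) (sym (trans (+-congʳ (zeroʳ _)) (+-identityˡ _)))
    where
    coefficient′ : Vector Carrier _
    coefficient′ zero    = 0#
    coefficient′ (suc i) = coefficient i

  column : ∀ {t} → Matrix t → Fin t → Vector Carrier t
  column A l i = A i l

  setColumn : ∀ {t} → Matrix t → Fin t → Vector Carrier t → Matrix t
  setColumn A l v i j with j ≟ l
  ... | yes _ = v i
  ... | no _  = A i j

  setColumn-≡ : ∀ {t} (A : Matrix t) l v i → setColumn A l v i l ≡ v i
  setColumn-≡ A l v i with l ≟ l
  ... | yes _   = ≡.refl
  ... | no l≢l = ⊥-elim (l≢l ≡.refl)

  setColumn-≢ : ∀ {t} (A : Matrix t) {l j} v i → j ≢ l → setColumn A l v i j ≡ A i j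
  setColumn-≢ A {l} {j} v i j≢l with j ≟ l
  ... | yes j≡l = ⊥-elim (j≢l j≡l)
  ... | no _    = ≡.refl

  setColumn-≈ : ∀ {t} (B : Matrix t) {l v} → (∀ i → B i l ≈ v i) → ∀ i k → B i k ≈ setColumn B l v i k
  setColumn-≈ B {l} {v} B≈v i k with k ≟ l
  ... | yes ≡.refl = B≈v i
  ... | no _       = refl

  minor-setColumn-≢ : ∀ {t} (A : Matrix (suc t)) {j l} (j≢l : j ≢ l) v i k →
                      minor (setColumn A l v) j i k ≡ setColumn (minor A j) (punchOut j≢l) (v ∘ suc) i k
  minor-setColumn-≢ A {j} {l} j≢l v i k with k ≟ punchOut j≢l
  ... | yes ≡.refl = ≡.trans (≡.cong (setColumn A l v (suc i)) (punchIn-punchOut j≢l)) (setColumn-≡ A l v (suc i))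
  ... | no k≢l′    = setColumn-≢ A v (suc i) λ eq →
    k≢l′ (punchIn-injective j k _ (≡.trans eq (≡.sym (punchIn-punchOut j≢l))))

  det-linear : ∀ {t} (A : Matrix t) l → IsLinearForm (λ v → det (setColumn A l v))
  det-linear {suc t} A l =
    isLinearForm-resp (λ v → det-expand (setColumn A l v)) (isLinearForm-sum (λ j → term-linear j (j ≟ l)))
    where
    term-linear : ∀ j → Dec (j ≡ l) →
                  IsLinearForm (λ v → sgn (toℕ j) * (setColumn A l v zero j * det (minor (setColumn A l v) j)))
    term-linear j (yes ≡.refl) = isLinearForm-resp (λ v → *-congˡ (*-cong
            (reflexive (setColumn-≡ A j v zero))
            (det-cong (λ i k → reflexive (setColumn-≢ A v (suc i) (punchInᵢ≢i j k))))))
          (isLinearForm-scale _ (isLinearForm-head (det (minor A j))))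
    term-linear j (no j≢l) = isLinearForm-resp (λ v → *-congˡ (*-cong
            (reflexive (setColumn-≢ A v zero j≢l))
            (det-cong (λ i k → reflexive (minor-setColumn-≢ A j≢l v i k)))))
          (isLinearForm-scale _ (isLinearForm-scale _ (isLinearForm-tail (det-linear (minor A j) (punchOut j≢l)))))

  SameColumns : ∀ {t} → Matrix t → Fin t → Fin t → Set ℓ
  SameColumns A a b = ∀ i → A i a ≈ A i b

  -- In the expansion along the first row the terms at a and b cancel (equal minors, opposite signs),
  -- and every other minor again has two equal adjacent columns.
  det-adjacent-same : ∀ {t} (A : Matrix t) {a b} → toℕ b ≡ suc (toℕ a) → SameColumns A a b → det A ≈ 0#
  det-adjacent-same {suc t} A {a} {b} b≡a+1 same = begin
    det A
      ≈⟨ det-expand A ⟩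
    sum T
      ≈⟨ sum-remove {i = a} T ⟩
    T a + sum (λ k → T (punchIn a k))
      ≈⟨ +-congˡ (sum-delta (λ k → T (punchIn a k)) (punchOut a≢b) others) ⟩
    T a + T (punchIn a (punchOut a≢b))
      ≡⟨ ≡.cong (λ j → T a + T j) (punchIn-punchOut a≢b) ⟩
    T a + T b
      ≈⟨ +-congˡ Tb≈-Ta ⟩
    T a - T a
      ≈⟨ -‿inverseʳ (T a) ⟩
    0# ∎
    where
    T : Vector Carrier (suc t)
    T j = sgn (toℕ j) * (A zero j * det (minor A j))
    a≢b = adjacent⇒≢ b≡a+1
    minor-a≈minor-b : ∀ i k → minor A a i k ≈ minor A b i k
    minor-a≈minor-b i k with punchIn-adjacent b≡a+1 k
    ... | inj₁ eq         = reflexive (≡.cong (A (suc i)) eq)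
    ... | inj₂ (eqa , eqb) = trans (reflexive (≡.cong (A (suc i)) eqa))
                               (trans (sym (same (suc i))) (reflexive (≡.cong (A (suc i)) (≡.sym eqb))))
    Tb≈-Ta : T b ≈ - T a
    Tb≈-Ta = begin
      sgn (toℕ b) * (A zero b * det (minor A b))
        ≡⟨ ≡.cong (λ n → sgn n * (A zero b * det (minor A b))) b≡a+1 ⟩
      - sgn (toℕ a) * (A zero b * det (minor A b))
        ≈⟨ *-congˡ (*-cong (sym (same zero)) (det-cong (λ i k → sym (minor-a≈minor-b i k)))) ⟩
      - sgn (toℕ a) * (A zero a * det (minor A a))
        ≈⟨ -‿distribˡ-* _ _ ⟨
      - T a ∎
    others : ∀ k → k ≢ punchOut a≢b → T (punchIn a k) ≈ 0#
    others k k≢b′ = trans (*-congˡ (trans (*-congˡ minor-singular) (zeroʳ _))) (zeroʳ _)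
      where
      j = punchIn a k
      j≢a = punchInᵢ≢i a k
      j≢b : j ≢ b
      j≢b j≡b = k≢b′ (punchIn-injective a k _ (≡.trans j≡b (≡.sym (punchIn-punchOut a≢b))))
      minor-singular : det (minor A j) ≈ 0#
      minor-singular = det-adjacent-same (minor A j) (punchOut-adjacent j≢a j≢b b≡a+1) λ i →
        trans (reflexive (≡.cong (A (suc i)) (punchIn-punchOut j≢a)))
              (trans (same (suc i)) (reflexive (≡.cong (A (suc i)) (≡.sym (punchIn-punchOut j≢b)))))

  setColumn-self : ∀ {t} (A : Matrix t) l i k → setColumn A l (column A l) i k ≡ A i k
  setColumn-self A l i k with k ≟ l
  ... | yes ≡.refl = ≡.refl
  ... | no _       = ≡.refl

  setColumn-comm : ∀ {t} (A : Matrix t) {a b} → a ≢ b → ∀ u w i k →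
                   setColumn (setColumn A a u) b w i k ≡ setColumn (setColumn A b w) a u i k
  setColumn-comm A {a} {b} a≢b u w i k with k ≟ a | k ≟ b
  ... | yes ≡.refl | yes ≡.refl = ⊥-elim (a≢b ≡.refl)
  ... | yes ≡.refl | no _       = setColumn-≡ A a u i
  ... | no _       | yes ≡.refl = ≡.sym (setColumn-≡ A b w i)
  ... | no k≢a     | no k≢b     = ≡.trans (setColumn-≢ A u i k≢a) (≡.sym (setColumn-≢ A w i k≢b))

  -- F below is bilinear and vanishes on the diagonal, hence antisymmetric.
  det-swap-adjacent : ∀ {t} (A : Matrix t) {a b} → toℕ b ≡ suc (toℕ a) →
                      det A + det (setColumn (setColumn A a (column A b)) b (column A a)) ≈ 0#
  det-swap-adjacent {t} A {a} {b} b≡a+1 = begin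
    det A + F cb ca
      ≈⟨ +-congʳ (det-cong restore) ⟨
    F ca cb + F cb ca
      ≈⟨ +-cong (+-identityˡ _) (+-identityʳ _) ⟨
    (0# + F ca cb) + (F cb ca + 0#)
      ≈⟨ +-cong (+-congʳ (F-diagonal ca)) (+-congˡ (F-diagonal cb)) ⟨
    (F ca ca + F ca cb) + (F cb ca + F cb cb)
      ≈⟨ +-cong (linearForm-+ (linear₂ ca) ca cb) (linearForm-+ (linear₂ cb) ca cb) ⟨
    F ca s + F cb s
      ≈⟨ linearForm-+ (linear₁ s) ca cb ⟨
    F s s
      ≈⟨ F-diagonal s ⟩
    0# ∎
    where
    a≢b = adjacent⇒≢ b≡a+1
    F : Vector Carrier t → Vector Carrier t → Carrier
    F u w = det (setColumn (setColumn A a u) b w)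
    ca cb s : Vector Carrier t
    ca = column A a
    cb = column A b
    s i = ca i + cb i
    linear₁ : ∀ w → IsLinearForm (λ u → F u w)
    linear₁ w = isLinearForm-resp (λ u → det-cong (λ i k → reflexive (setColumn-comm A a≢b u w i k)))
                               (det-linear (setColumn A b w) a)
    linear₂ : ∀ u → IsLinearForm (F u)
    linear₂ u = det-linear (setColumn A a u) b
    restore : ∀ i k → setColumn (setColumn A a ca) b cb i k ≈ A i k
    restore i k with k ≟ b
    ... | yes ≡.refl = refl
    ... | no _       = reflexive (setColumn-self A a i k)
    F-diagonal : ∀ x → F x x ≈ 0#
    F-diagonal x = det-adjacent-same (setColumn (setColumn A a x) b x) b≡a+1 λ i → begin
      setColumn (setColumn A a x) b x i a ≡⟨ setColumn-≢ (setColumn A a x) x i a≢b ⟩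
      setColumn A a x i a                 ≡⟨ setColumn-≡ A a x i ⟩
      x i                                 ≡⟨ setColumn-≡ (setColumn A a x) b x i ⟨
      setColumn (setColumn A a x) b x i b ∎

  -- Swapping the column just before b with b brings the two equal columns one step closer.
  det-same-columns-at-distance : ∀ d {t} (A : Matrix t) {a b} → suc (toℕ a ℕ.+ d) ≡ toℕ b →
                                 SameColumns A a b → det A ≈ 0#
  det-same-columns-at-distance zero A {a} b≡a+1 same =
    det-adjacent-same A (≡.trans (≡.sym b≡a+1) (≡.cong suc (ℕ.+-identityʳ (toℕ a)))) same
  det-same-columns-at-distance (suc d) {t} A {a} {b} b≡a+d+2 same = begin
    det A           ≈⟨ +-identityʳ (det A) ⟨
    det A + 0#      ≈⟨ +-congˡ (det-same-columns-at-distance d A′ (≡.sym (toℕ-fromℕ< b′<t)) same′) ⟨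
    det A + det A′  ≈⟨ det-swap-adjacent A b≡b′+1 ⟩
    0#              ∎
    where
    b′<t : suc (toℕ a ℕ.+ d) ℕ.< t
    b′<t = ℕ.<-trans (s≤s (ℕ.+-monoʳ-< (toℕ a) (ℕ.n<1+n d)))
                     (≡.subst (ℕ._< t) (≡.sym b≡a+d+2) (toℕ<n b))
    b′ : Fin t
    b′ = fromℕ< b′<t
    b≡b′+1 : toℕ b ≡ suc (toℕ b′)
    b≡b′+1 = ≡.trans (≡.sym b≡a+d+2)
                     (≡.cong suc (≡.trans (ℕ.+-suc (toℕ a) d) (≡.sym (toℕ-fromℕ< b′<t))))
    A′ : Matrix t
    A′ = setColumn (setColumn A b′ (column A b)) b (column A b′)
    a<b′ : toℕ a ℕ.< toℕ b′
    a<b′ = ≡.subst (toℕ a ℕ.<_) (≡.sym (toℕ-fromℕ< b′<t)) (s≤s (ℕ.m≤m+n (toℕ a) d))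
    a<b : toℕ a ℕ.< toℕ b
    a<b = ℕ.<-trans a<b′ (ℕ.≤-reflexive (≡.sym b≡b′+1))
    b′≢b : b′ ≢ b
    b′≢b = <⇒≢ (ℕ.≤-reflexive (≡.sym b≡b′+1))
    same′ : SameColumns A′ a b′
    same′ i = begin
      A′ i a
        ≡⟨ setColumn-≢ (setColumn A b′ (column A b)) (column A b′) i (<⇒≢ a<b) ⟩
      setColumn A b′ (column A b) i a
        ≡⟨ setColumn-≢ A (column A b) i (<⇒≢ a<b′) ⟩
      A i a
        ≈⟨ same i ⟩
      A i b
        ≡⟨ setColumn-≡ A b′ (column A b) i ⟨
      setColumn A b′ (column A b) i b′
        ≡⟨ setColumn-≢ (setColumn A b′ (column A b)) (column A b′) i b′≢b ⟨
      A′ i b′ ∎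

  det-same-columns : ∀ {t} (A : Matrix t) {a b} → a ≢ b → SameColumns A a b → det A ≈ 0#
  det-same-columns A {a} {b} a≢b same with ℕ.<-cmp (toℕ a) (toℕ b)
  ... | tri< a<b _ _ = det-same-columns-at-distance _ A (proj₂ (ℕ.m≤n⇒∃[o]m+o≡n a<b)) same
  ... | tri≈ _ a≡b _ = ⊥-elim (a≢b (toℕ-injective a≡b))
  ... | tri> _ _ b<a = det-same-columns-at-distance _ A (proj₂ (ℕ.m≤n⇒∃[o]m+o≡n b<a)) (sym ∘ same)

  AnnihilatesMinors : ∀ {Row Col : Set} → Carrier → (Row → Col → Carrier) → ℕ → Set ℓ
  AnnihilatesMinors {Row} {Col} r M t =
    ∀ (ρ : Fin t → Row) (γ : Fin t → Col) → r * det (λ i j → M (ρ i) (γ j)) ≈ 0#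

  module _ {t m} (A : Fin t → Fin m → Carrier) (r : Carrier)
           (basic : ∀ (σ : Fin t → Fin m) → r * det (λ i l → A i (σ l)) ≈ 0#) where

    private
      InSpan : Vector Carrier t → Set (c ⊔ ℓ)
      InSpan v = ∃ λ (w : Vector Carrier m) → ∀ i → v i ≈ sum (λ k → w k * A i k)

      IsColumn : Vector Carrier t → Set ℓ
      IsColumn v = ∃ λ k → ∀ i → v i ≈ A i k

      -- Induction on the number j of leading columns only known to lie in the span of the columns of A:
      -- by multilinearity the last of them can be expanded into columns of A.
      Annihilated : ℕ → Set (c ⊔ ℓ)
      Annihilated j = ∀ (B : Matrix t) → (∀ l → toℕ l ℕ.< j → InSpan (column B l)) →
                      (∀ l → j ℕ.≤ toℕ l → IsColumn (column B l)) → r * det B ≈ 0#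

      annihilated-zero : Annihilated 0
      annihilated-zero B _ isColumn = trans (*-congˡ (det-cong (λ i l → proj₂ (isColumn l z≤n) i)))
                                            (basic (λ l → proj₁ (isColumn l z≤n)))

      annihilated-suc : ∀ j → j ℕ.< t → Annihilated j → Annihilated (suc j)
      annihilated-suc j j<t annihilated B inSpan isColumn = begin
        r * det B
          ≈⟨ *-congˡ (det-cong B≈) ⟩
        r * det (setColumn B l₀ (λ i → sum (λ k → w k * A i k)))
          ≈⟨ *-congˡ (linearForm-combination (det-linear B l₀) w (λ k i → A i k)) ⟩
        r * sum (λ k → w k * det (B[ k ]))
          ≈⟨ *-distribˡ-sum r (λ k → w k * det (B[ k ])) ⟩
        sum (λ k → r * (w k * det (B[ k ])))
          ≈⟨ sum-zero (λ k → trans (x∙yz≈y∙xz r (w k) _) (trans (*-congˡ annihilated-B[ k ]) (zeroʳ (w k)))) ⟩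
        0# ∎
        where
        l₀ = fromℕ< j<t
        w = proj₁ (inSpan l₀ (ℕ.≤-reflexive (≡.cong suc (toℕ-fromℕ< j<t))))
        B[_] : Fin m → Matrix t
        B[ k ] = setColumn B l₀ (λ i → A i k)
        B≈ : ∀ i l → B i l ≈ setColumn B l₀ (λ i → sum (λ k → w k * A i k)) i l
        B≈ = setColumn-≈ B (proj₂ (inSpan l₀ (ℕ.≤-reflexive (≡.cong suc (toℕ-fromℕ< j<t)))))
        toℕ-l₀ : ∀ {l} → l ≡ l₀ → toℕ l ≡ j
        toℕ-l₀ ≡.refl = toℕ-fromℕ< j<t
        annihilated-B[_] : ∀ k → r * det (B[ k ]) ≈ 0#
        annihilated-B[ k ] = annihilated B[ k ] inSpan′ isColumn′
          where
          inSpan′ : ∀ l → toℕ l ℕ.< j → InSpan (column B[ k ] l)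
          inSpan′ l l<j with l ≟ l₀
          ... | yes l≡l₀ = ⊥-elim (ℕ.<-irrefl (toℕ-l₀ l≡l₀) l<j)
          ... | no _     = inSpan l (ℕ.m<n⇒m<1+n l<j)
          isColumn′ : ∀ l → j ℕ.≤ toℕ l → IsColumn (column B[ k ] l)
          isColumn′ l j≤l with l ≟ l₀
          ... | yes _   = k , λ i → refl
          ... | no l≢l₀ = isColumn l j<l
            where
            j<l : j ℕ.< toℕ l
            j<l = ℕ.≤∧≢⇒< j≤l λ j≡l →
              l≢l₀ (toℕ-injective (≡.trans (≡.sym j≡l) (≡.sym (toℕ-fromℕ< j<t))))

      annihilated : ∀ j → j ℕ.≤ t → Annihilated j
      annihilated zero    _     = annihilated-zero
      annihilated (suc j) j+1≤t = annihilated-suc j j+1≤t (annihilated j (ℕ.<⇒≤ j+1≤t))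

    annihilates-combinations : ∀ (W : Fin t → Vector Carrier m) → r * det (λ i l → sum (λ k → W l k * A i k)) ≈ 0#
    annihilates-combinations W = annihilated t ℕ.≤-refl _
      (λ l _ → W l , λ i → refl)
      (λ l t≤l → ⊥-elim (ℕ.<⇒≱ (toℕ<n l) t≤l))

  annihilatesMinors-span : ∀ {Row Col : Set} {m} (A : Row → Fin m → Carrier) (M : Row → Col → Carrier)
                           (W : Col → Vector Carrier m) → (∀ R e → M R e ≈ sum (λ k → W e k * A R k)) →
                           ∀ {r t} → AnnihilatesMinors r A t → AnnihilatesMinors r M t
  annihilatesMinors-span A M W M≈ {r} annihilates ρ γ =
    trans (*-congˡ (det-cong (λ i l → M≈ (ρ i) (γ l))))
          (annihilates-combinations (λ i k → A (ρ i) k) r (annihilates ρ) (W ∘ γ))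

  minors-vanish-beyond-width : ∀ {Row : Set} {m t} (A : Row → Fin m → Carrier) → m ℕ.< t →
                               ∀ (ρ : Fin t → Row) γ → det (λ i j → A (ρ i) (γ j)) ≈ 0#
  minors-vanish-beyond-width A m<t ρ γ with pigeonhole m<t γ
  ... | i , j , i<j , γi≡γj = det-same-columns _ (<⇒≢ i<j) (λ k → reflexive (≡.cong (A (ρ k)) γi≡γj))

  δ : ∀ {m} → Fin m → Fin m → Carrier
  δ j k with j ≟ k
  ... | yes _ = 1#
  ... | no _  = 0#

  δ-diagonal : ∀ {m} (j : Fin m) → δ j j ≈ 1#
  δ-diagonal j with j ≟ j
  ... | yes _   = refl
  ... | no j≢j = ⊥-elim (j≢j ≡.refl)

  δ-off-diagonal : ∀ {m} {j k : Fin m} → j ≢ k → δ j k ≈ 0#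
  δ-off-diagonal {j = j} {k} j≢k with j ≟ k
  ... | yes j≡k = ⊥-elim (j≢k j≡k)
  ... | no _    = refl

  sum-δ : ∀ {m} (v : Vector Carrier m) j → sum (λ k → v k * δ j k) ≈ v j
  sum-δ v j =
    trans (sum-delta (λ k → v k * δ j k) j off-diagonal) (trans (*-congˡ (δ-diagonal j)) (*-identityʳ (v j)))
    where
    off-diagonal : ∀ k → k ≢ j → v k * δ j k ≈ 0#
    off-diagonal k k≢j = trans (*-congˡ (δ-off-diagonal (k≢j ∘ ≡.sym))) (zeroʳ (v k))

  sum-δ-combination : ∀ {m s} (v : Vector Carrier m) (γ : Fin s → Fin m) (a : Vector Carrier s) →
                      sum (λ k → v k * sum (λ p → δ (γ p) k * a p)) ≈ sum (λ p → v (γ p) * a p)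
  sum-δ-combination v γ a = begin
    sum (λ k → v k * sum (λ p → δ (γ p) k * a p))
      ≈⟨ sum-cong-≋ (λ k → *-distribˡ-sum (v k) (λ p → δ (γ p) k * a p)) ⟩
    sum (λ k → sum (λ p → v k * (δ (γ p) k * a p)))
      ≈⟨ ∑-comm (λ k p → v k * (δ (γ p) k * a p)) ⟩
    sum (λ p → sum (λ k → v k * (δ (γ p) k * a p)))
      ≈⟨ sum-cong-≋ (λ p → sum-cong-≋ (λ k → *-assoc (v k) (δ (γ p) k) (a p))) ⟨
    sum (λ p → sum (λ k → v k * δ (γ p) k * a p))
      ≈⟨ sum-cong-≋ (λ p → *-distribʳ-sum (a p) (λ k → v k * δ (γ p) k)) ⟨
    sum (λ p → sum (λ k → v k * δ (γ p) k) * a p)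
      ≈⟨ sum-cong-≋ (λ p → *-congʳ (sum-δ v (γ p))) ⟩
    sum (λ p → v (γ p) * a p) ∎

  InKernel : ∀ {Row : Set} {m} → (Row → Fin m → Carrier) → Vector Carrier m → Set ℓ
  InKernel A x = ∀ i → sum (λ k → A i k * x k) ≈ 0#

  HasTrivialKernel : ∀ {Row : Set} {m} → (Row → Fin m → Carrier) → Set (c ⊔ ℓ)
  HasTrivialKernel A = ∀ x → InKernel A x → ∀ k → x k ≈ 0#

  cramer : ∀ {m} (A : Matrix m) {x} → InKernel A x → (σ : Fin m → Fin m) → (∀ k → ∃ λ l → σ l ≡ k) →
           ∀ j → x j * det (λ i l → A i (σ l)) ≈ 0#
  cramer {m} A {x} Ax≈0 σ surjective j = begin
    x j * det B
      ≈⟨ *-congˡ (det-cong (setColumn-≈ B (λ i → reflexive (≡.cong (A i) (proj₂ (surjective j)))))) ⟩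
    x j * G (column A j)
      ≈⟨ sum-delta (λ k → x k * G (column A k)) j others ⟨
    sum (λ k → x k * G (column A k))
      ≈⟨ linearForm-combination (det-linear B l₀) x (column A) ⟨
    G (λ i → sum (λ k → x k * A i k))
      ≈⟨ linearForm-zero (det-linear B l₀) (λ i → trans (sum-cong-≋ (λ k → *-comm (x k) (A i k))) (Ax≈0 i)) ⟩
    0# ∎
    where
    B : Matrix m
    B i l = A i (σ l)
    l₀ = proj₁ (surjective j)
    G : Vector Carrier m → Carrier
    G v = det (setColumn B l₀ v)
    others : ∀ k → k ≢ j → x k * G (column A k) ≈ 0#
    others k k≢j = trans (*-congˡ (det-same-columns (setColumn B l₀ (column A k)) l₀≢lₖ same)) (zeroʳ (x k))
      where
      lₖ = proj₁ (surjective k)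
      l₀≢lₖ : l₀ ≢ lₖ
      l₀≢lₖ l₀≡lₖ = k≢j (≡.trans (≡.sym (proj₂ (surjective k)))
                                 (≡.trans (≡.cong σ (≡.sym l₀≡lₖ)) (proj₂ (surjective j))))
      same : SameColumns (setColumn B l₀ (column A k)) l₀ lₖ
      same i = reflexive (≡.trans (setColumn-≡ B l₀ (column A k) i)
                                  (≡.sym (≡.trans (setColumn-≢ B (column A k) i (l₀≢lₖ ∘ ≡.sym))
                                                  (≡.cong (A i) (proj₂ (surjective k))))))

  kernel-annihilatesMinors : ∀ {Row : Set} {m} (A : Row → Fin m → Carrier) {x} → InKernel A x →
                             ∀ j → AnnihilatesMinors (x j) A m
  kernel-annihilatesMinors A Ax≈0 j ρ σ with surjective-or-collision σ
  ... | inj₁ surjective = cramer (λ i → A (ρ i)) (Ax≈0 ∘ ρ) σ surjective j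
  ... | inj₂ (l , l′ , l≢l′ , σl≡σl′) =
    trans (*-congˡ (det-same-columns _ l≢l′ (λ i → reflexive (≡.cong (A (ρ i)) σl≡σl′)))) (zeroʳ _)

  minorAnnZero⇒trivialKernel : ∀ {Row : Set} {m} (A : Row → Fin m → Carrier) →
                               MinorAnnZero R A m → HasTrivialKernel A
  minorAnnZero⇒trivialKernel A faithful x Ax≈0 j = faithful (x j) (kernel-annihilatesMinors A Ax≈0 j)

  module _ {Row : Set} {m} (A : Row → Fin m → Carrier) (trivial : HasTrivialKernel A) (r : Carrier) where

    -- The signed cofactors of a (t+1)-minor whose first column misses the columns of a t-minor
    -- form a kernel vector; its entry at the missing column is r times the t-minor.
    annihilatesMinors-pred : ∀ {t} → t ℕ.< m → AnnihilatesMinors r A (suc t) → AnnihilatesMinors r A t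
    annihilatesMinors-pred {t} t<m annihilates ρ γ = begin
      r * det (λ i j → A (ρ i) (γ j))              ≈⟨ *-congˡ (*-identityˡ _) ⟨
      r * cofactor zero                             ≈⟨ trans (*-congʳ (δ-diagonal j₀)) (*-identityˡ _) ⟨
      δ j₀ j₀ * (r * cofactor zero)                 ≈⟨ sum-delta (λ p → δ (γ′ p) j₀ * (r * cofactor p)) zero missed ⟨
      sum (λ p → δ (γ′ p) j₀ * (r * cofactor p))    ≈⟨ trivial x Ax≈0 j₀ ⟩
      0#                                            ∎
      where
      j₀ = proj₁ (missing-value γ t<m)
      γ′ : Fin (suc t) → Fin m
      γ′ zero    = j₀
      γ′ (suc l) = γ l
      ρ′ : Row → Fin (suc t) → Row
      ρ′ row zero    = row
      ρ′ row (suc i) = ρ i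
      minor′ cofactor : Fin (suc t) → Carrier
      minor′ p   = det (λ i j → A (ρ i) (γ′ (punchIn p j)))
      cofactor p = sgn (toℕ p) * minor′ p
      x : Vector Carrier m
      x k = sum (λ p → δ (γ′ p) k * (r * cofactor p))
      missed : ∀ p → p ≢ zero → δ (γ′ p) j₀ * (r * cofactor p) ≈ 0#
      missed zero    p≢0 = ⊥-elim (p≢0 ≡.refl)
      missed (suc l) _   = trans (*-congʳ (δ-off-diagonal (proj₂ (missing-value γ t<m) l))) (zeroˡ _)
      Ax≈0 : InKernel A x
      Ax≈0 row = begin
        sum (λ k → A row k * x k)
          ≈⟨ sum-δ-combination (A row) γ′ (λ p → r * cofactor p) ⟩
        sum (λ p → A row (γ′ p) * (r * (sgn (toℕ p) * minor′ p)))
          ≈⟨ sum-cong-≋ (λ p → trans (x∙yz≈y∙xz _ r _) (*-congˡ (x∙yz≈y∙xz (A row (γ′ p)) (sgn (toℕ p)) (minor′ p)))) ⟩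
        sum (λ p → r * (sgn (toℕ p) * (A row (γ′ p) * minor′ p)))
          ≈⟨ *-distribˡ-sum r (λ p → sgn (toℕ p) * (A row (γ′ p) * minor′ p)) ⟨
        r * sum (λ p → sgn (toℕ p) * (A row (γ′ p) * minor′ p))
          ≈⟨ *-congˡ (det-expand (λ i j → A (ρ′ row i) (γ′ j))) ⟨
        r * det (λ i j → A (ρ′ row i) (γ′ j))
          ≈⟨ annihilates (ρ′ row) γ′ ⟩
        0# ∎

    annihilatesMinors-below : ∀ d {t} → d ℕ.+ t ≡ m → AnnihilatesMinors r A m → AnnihilatesMinors r A t
    annihilatesMinors-below zero    ≡.refl annihilates = annihilates
    annihilatesMinors-below (suc d) {t} d+1+t≡m annihilates =
      annihilatesMinors-pred t<m (annihilatesMinors-below d (≡.trans (ℕ.+-suc d t) d+1+t≡m) annihilates)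
      where
      t<m : t ℕ.< m
      t<m = ≡.subst (t ℕ.<_) d+1+t≡m (ℕ.m<n+m t (s≤s z≤n))

  trivialKernel⇒minorAnnZero : ∀ {Row : Set} {m} (A : Row → Fin m → Carrier) →
                               HasTrivialKernel A → MinorAnnZero R A m
  trivialKernel⇒minorAnnZero {m = m} A trivial r annihilates =
    trans (sym (*-identityʳ r))
          (annihilatesMinors-below A trivial r m (ℕ.+-identityʳ m) annihilates (λ ()) (λ ()))

  trivialKernel⇔minorAnnZero : ∀ {Row : Set} {m} (A : Row → Fin m → Carrier) →
                               HasTrivialKernel A ⇔ MinorAnnZero R A m
  trivialKernel⇔minorAnnZero A = mk⇔ (trivialKernel⇒minorAnnZero A) (minorAnnZero⇒trivialKernel A)

  module _ {Row Col : Set} {m} (M : Row → Col → Carrier) (ι : Fin m → Col) (W : Col → Vector Carrier m)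
           (M≈ : ∀ i e → M i e ≈ sum (λ k → W e k * M i (ι k))) where

    minorAnnZero-columnSpan : ∀ {t} → MinorAnnZero R M t ⇔ MinorAnnZero R (λ i k → M i (ι k)) t
    minorAnnZero-columnSpan = mk⇔
      (λ faithful r annihilates → faithful r (annihilatesMinors-span (λ i k → M i (ι k)) M W M≈ annihilates))
      (λ faithful r annihilates → faithful r (λ ρ γ → annihilates ρ (ι ∘ γ)))

    minorAnnZero⇒≤width : ¬ (1# ≈ 0#) → ∀ {t} → MinorAnnZero R M t → t ℕ.≤ m
    minorAnnZero⇒≤width 1≉0 {t} faithful with t ℕ.≤? m
    ... | yes t≤m = t≤m
    ... | no t≰m  = ⊥-elim (1≉0 (faithful 1# (annihilatesMinors-span (λ i k → M i (ι k)) M W M≈ λ ρ γ →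
      trans (*-identityˡ _) (minors-vanish-beyond-width (λ i k → M i (ι k)) (ℕ.≰⇒> t≰m) ρ γ))))

    rank≡width⇔minorAnnZero : ¬ (1# ≈ 0#) → ∀ {ρ} → IsRank R M ρ → (ρ ≡ m) ⇔ MinorAnnZero R M m
    rank≡width⇔minorAnnZero 1≉0 (faithful , maximal) = mk⇔
      (λ { ≡.refl → faithful })
      (λ faithfulₘ → ℕ.≤-antisym (minorAnnZero⇒≤width 1≉0 faithful) (maximal _ faithfulₘ))

module Counting where

  private
    variable
      p q : Level
      n C : ℕ

  count : {P : Pred (Fin n) p} → Decidable P → ℕ
  count {n = zero}  P? = 0
  count {n = suc n} P? with P? zero
  ... | yes _ = suc (count (P? ∘ suc))
  ... | no _  = count (P? ∘ suc)

  count-mono : {P : Pred (Fin n) p} {Q : Pred (Fin n) q} (P? : Decidable P) (Q? : Decidable Q) →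
               P ⊆ Q → count P? ℕ.≤ count Q?
  count-mono {n = zero}  P? Q? P⊆Q = z≤n
  count-mono {n = suc n} P? Q? P⊆Q with P? zero | Q? zero
  ... | yes _  | yes _  = s≤s (count-mono (P? ∘ suc) (Q? ∘ suc) P⊆Q)
  ... | no _   | yes _  = ℕ.m≤n⇒m≤1+n (count-mono (P? ∘ suc) (Q? ∘ suc) P⊆Q)
  ... | no _   | no _   = count-mono (P? ∘ suc) (Q? ∘ suc) P⊆Q
  ... | yes px | no ¬qx = ⊥-elim (¬qx (P⊆Q px))

  count-strictMono : {P : Pred (Fin n) p} {Q : Pred (Fin n) q} (P? : Decidable P) (Q? : Decidable Q) → P ⊆ Q →
                     ∀ w → Q w → ¬ P w → count P? ℕ.< count Q?
  count-strictMono {n = suc n} P? Q? P⊆Q zero qw ¬pw with P? zero | Q? zero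
  ... | yes pw | _      = ⊥-elim (¬pw pw)
  ... | no _   | yes _  = s≤s (count-mono (P? ∘ suc) (Q? ∘ suc) P⊆Q)
  ... | no _   | no ¬qw = ⊥-elim (¬qw qw)
  count-strictMono {n = suc n} P? Q? P⊆Q (suc w) qw ¬pw with P? zero | Q? zero
  ... | yes _  | yes _  = s≤s (count-strictMono (P? ∘ suc) (Q? ∘ suc) P⊆Q w qw ¬pw)
  ... | no _   | yes _  = ℕ.m≤n⇒m≤1+n (count-strictMono (P? ∘ suc) (Q? ∘ suc) P⊆Q w qw ¬pw)
  ... | no _   | no _   = count-strictMono (P? ∘ suc) (Q? ∘ suc) P⊆Q w qw ¬pw
  ... | yes px | no ¬qx = ⊥-elim (¬qx (P⊆Q px))

  count-cong : {P : Pred (Fin n) p} {Q : Pred (Fin n) q} (P? : Decidable P) (Q? : Decidable Q) →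
               P ⊆ Q → Q ⊆ P → count P? ≡ count Q?
  count-cong P? Q? P⊆Q Q⊆P = ℕ.≤-antisym (count-mono P? Q? P⊆Q) (count-mono Q? P? Q⊆P)

  count-all : {P : Pred (Fin n) p} (P? : Decidable P) → (∀ x → P x) → count P? ≡ n
  count-all {n = zero}  P? all = ≡.refl
  count-all {n = suc n} P? all with P? zero
  ... | yes _ = ≡.cong suc (count-all (P? ∘ suc) (all ∘ suc))
  ... | no ¬p = ⊥-elim (¬p (all zero))

  count-remove : {P : Pred (Fin n) p} {Q : Pred (Fin n) q} (P? : Decidable P) (Q? : Decidable Q) →
                 ∀ z → P z → ¬ Q z → Q ⊆ P → (∀ {x} → P x → x ≢ z → Q x) → count P? ≡ suc (count Q?)
  count-remove {n = suc n} P? Q? zero pz ¬qz Q⊆P keep with P? zero | Q? zero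
  ... | _      | yes qz = ⊥-elim (¬qz qz)
  ... | no ¬pz | no _   = ⊥-elim (¬pz pz)
  ... | yes _  | no _   = ≡.cong suc (count-cong (P? ∘ suc) (Q? ∘ suc) (λ px → keep px λ ()) Q⊆P)
  count-remove {n = suc n} P? Q? (suc z) pz ¬qz Q⊆P keep with P? zero | Q? zero
  ... | yes _  | yes _  = ≡.cong suc (count-remove (P? ∘ suc) (Q? ∘ suc) z pz ¬qz Q⊆P
                            (λ px x≢z → keep px (x≢z ∘ suc-injective)))
  ... | no _   | no _   = count-remove (P? ∘ suc) (Q? ∘ suc) z pz ¬qz Q⊆P
                            (λ px x≢z → keep px (x≢z ∘ suc-injective))
  ... | yes p0 | no ¬q0 = ⊥-elim (¬q0 (keep p0 λ ()))
  ... | no ¬p0 | yes q0 = ⊥-elim (¬p0 (Q⊆P q0))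

  enumerate : {P : Pred (Fin n) p} (P? : Decidable P) → Fin (count P?) → Fin n
  enumerate {n = suc n} P? i with P? zero
  enumerate P? zero    | yes _ = zero
  enumerate P? (suc i) | yes _ = suc (enumerate (P? ∘ suc) i)
  enumerate P? i       | no _  = suc (enumerate (P? ∘ suc) i)

  enumerate-sound : {P : Pred (Fin n) p} (P? : Decidable P) (i : Fin (count P?)) → P (enumerate P? i)
  enumerate-sound {n = suc n} P? i with P? zero
  enumerate-sound P? zero    | yes p0 = p0
  enumerate-sound P? (suc i) | yes _  = enumerate-sound (P? ∘ suc) i
  enumerate-sound P? i       | no _   = enumerate-sound (P? ∘ suc) i

  enumerate-injective : {P : Pred (Fin n) p} (P? : Decidable P) →
                        ∀ i j → enumerate P? i ≡ enumerate P? j → i ≡ j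
  enumerate-injective {n = suc n} P? i j eq with P? zero
  enumerate-injective P? zero    zero    eq | yes _ = ≡.refl
  enumerate-injective P? (suc i) (suc j) eq | yes _ =
    ≡.cong suc (enumerate-injective (P? ∘ suc) i j (suc-injective eq))
  enumerate-injective P? i       j       eq | no _  =
    enumerate-injective (P? ∘ suc) i j (suc-injective eq)

  index : {P : Pred (Fin n) p} (P? : Decidable P) → ∀ x → P x → Fin (count P?)
  index {n = suc n} P? x px with P? zero
  index P? zero    px | yes _  = zero
  index P? (suc x) px | yes _  = suc (index (P? ∘ suc) x px)
  index P? zero    px | no ¬px = ⊥-elim (¬px px)
  index P? (suc x) px | no _   = index (P? ∘ suc) x px

  enumerate-index : {P : Pred (Fin n) p} (P? : Decidable P) → ∀ x (px : P x) → enumerate P? (index P? x px) ≡ x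
  enumerate-index {n = suc n} P? x px with P? zero
  enumerate-index P? zero    px | yes _  = ≡.refl
  enumerate-index P? (suc x) px | yes _  = ≡.cong suc (enumerate-index (P? ∘ suc) x px)
  enumerate-index P? zero    px | no ¬px = ⊥-elim (¬px px)
  enumerate-index P? (suc x) px | no _   = ≡.cong suc (enumerate-index (P? ∘ suc) x px)

  count-bijection : {P : Pred (Fin n) p} (P? : Decidable P) (f : Fin n → Fin C) →
                    (∀ {x y} → P x → P y → f x ≡ f y → x ≡ y) →
                    (∀ c → ∃ λ x → P x × f x ≡ c) → count P? ≡ C
  count-bijection P? f injective surjective =
    cantor-schröder-bernstein {f = f ∘ enumerate P?} {g = g} f∘enumerate-injective g-injective
    where
    g : Fin _ → Fin (count P?)
    g c = index P? (proj₁ (surjective c)) (proj₁ (proj₂ (surjective c)))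
    f∘enumerate-injective : ∀ {i j} → f (enumerate P? i) ≡ f (enumerate P? j) → i ≡ j
    f∘enumerate-injective {i} {j} eq = enumerate-injective P? i j
      (injective (enumerate-sound P? i) (enumerate-sound P? j) eq)
    g-injective : ∀ {c d} → g c ≡ g d → c ≡ d
    g-injective {c} {d} eq = begin
      c                                          ≡⟨ proj₂ (proj₂ (surjective c)) ⟨
      f (proj₁ (surjective c))                   ≡⟨ ≡.cong f (enumerate-index P? _ _) ⟨
      f (enumerate P? (g c))                     ≡⟨ ≡.cong (f ∘ enumerate P?) eq ⟩
      f (enumerate P? (g d))                     ≡⟨ ≡.cong f (enumerate-index P? _ _) ⟩
      f (proj₁ (surjective d))                   ≡⟨ proj₂ (proj₂ (surjective d)) ⟩
      d                                          ∎
      where open ≡.≡-Reasoning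

module HasseDiagram (P : FinitePoset) where

  open FinitePoset P
  open IsPartialOrder isPartialOrder using () renaming (refl to ≼-refl; trans to ≼-trans; antisym to ≼-antisym)
  open Counting

  ⋖⇒≼ : ∀ {a b} → a ⋖ b → a ≼ b
  ⋖⇒≼ = proj₁ ∘ proj₁

  path⇒≼ : ∀ {x y} → HPath x y → x ≼ y
  path⇒≼ []      = ≼-refl
  path⇒≼ (a⋖b ∷ p) = ≼-trans (⋖⇒≼ a⋖b) (path⇒≼ p)

  _++ₚ_ : ∀ {x y z} → HPath x y → HPath y z → HPath x z
  []        ++ₚ q = q
  (a⋖b ∷ p) ++ₚ q = a⋖b ∷ (p ++ₚ q)

  intervalSize : Fin size → Fin size → ℕ
  intervalSize x y = count (λ z → (x ≼? z) ×-dec (z ≼? y))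

  intervalSize-lower : ∀ {x y z} → x ≼ y → y ≺ z → intervalSize x y ℕ.< intervalSize x z
  intervalSize-lower {x} {y} {z} x≼y (y≼z , y≢z) =
    count-strictMono _ _ (λ (x≼w , w≼y) → x≼w , ≼-trans w≼y y≼z) z (≼-trans x≼y y≼z , ≼-refl)
                     (λ (_ , z≼y) → y≢z (≼-antisym y≼z z≼y))

  intervalSize-upper : ∀ {x y z} → x ≺ y → y ≼ z → intervalSize y z ℕ.< intervalSize x z
  intervalSize-upper {x} {y} {z} (x≼y , x≢y) y≼z =
    count-strictMono _ _ (λ (y≼w , w≼z) → ≼-trans x≼y y≼w , w≼z) x (≼-refl , ≼-trans x≼y y≼z)
                     (λ (y≼x , _) → x≢y (≼-antisym x≼y y≼x))

  saturatedChain′ : ∀ n {x y} → intervalSize x y ℕ.< n → x ≼ y → HPath x y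
  saturatedChain′ (suc n) {x} {y} [x,y]<n x≼y with x ≟ y
  ... | yes ≡.refl = []
  ... | no x≢y with any? (λ z → (x ≺? z) ×-dec (z ≺? y))
  ...   | no nothing-between = ((x≼y , x≢y) , λ z between → nothing-between (z , between)) ∷ []
  ...   | yes (z , x≺z , z≺y) =
    saturatedChain′ n (ℕ.<-≤-trans (intervalSize-lower (proj₁ x≺z) z≺y) (ℕ.≤-pred [x,y]<n)) (proj₁ x≺z) ++ₚ
    saturatedChain′ n (ℕ.<-≤-trans (intervalSize-upper x≺z (proj₁ z≺y)) (ℕ.≤-pred [x,y]<n)) (proj₁ z≺y)

  saturatedChain : ∀ {x y} → x ≼ y → HPath x y
  saturatedChain = saturatedChain′ _ (ℕ.n<1+n _)

module TransitiveFunctions {c ℓ} (R : CommutativeRing c ℓ) (P : FinitePoset) where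

  open FinitePoset P
  open HasseDiagram P
  open IsPartialOrder isPartialOrder using () renaming (refl to ≼-refl; trans to ≼-trans)
  open CommutativeRing R hiding (zero)
  open RingDifferences R
  open import Algebra.Properties.Ring ring using (-‿+-comm; x+x≈x⇒x≈0)
  open import Algebra.Properties.CommutativeSemigroup +-commutativeSemigroup using (interchange)
  open import Relation.Binary.Reasoning.Setoid setoid

  PairFunction : Set c
  PairFunction = Fin size → Fin size → Carrier

  pathSum : ∀ {x y} → HPath x y → PairFunction → Carrier
  pathSum []                   g = 0#
  pathSum (_∷_ {x} {z} _ p) g = g x z + pathSum p g

  pathSum-++ : ∀ {x y z} (p : HPath x y) (q : HPath y z) g → pathSum (p ++ₚ q) g ≈ pathSum p g + pathSum q g
  pathSum-++ []                   q g = sym (+-identityˡ _)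
  pathSum-++ (_∷_ {x} {w} _ p) q g = trans (+-congˡ (pathSum-++ p q g)) (sym (+-assoc (g x w) _ _))

  pathSum-cong : ∀ {x y} (p : HPath x y) {g h : PairFunction} → (∀ {a b} → a ⋖ b → g a b ≈ h a b) →
                 pathSum p g ≈ pathSum p h
  pathSum-cong []        g≈h = refl
  pathSum-cong (a⋖b ∷ p) g≈h = +-cong (g≈h a⋖b) (pathSum-cong p g≈h)

  pathSum-− : ∀ {x y} (p : HPath x y) (g h : PairFunction) →
              pathSum p (λ u v → g u v - h u v) ≈ pathSum p g - pathSum p h
  pathSum-− []                   g h = sym (-‿inverseʳ 0#)
  pathSum-− (_∷_ {x} {z} _ p) g h = begin
    (g x z - h x z) + pathSum p (λ u v → g u v - h u v)
      ≈⟨ +-congˡ (pathSum-− p g h) ⟩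
    (g x z - h x z) + (pathSum p g - pathSum p h)
      ≈⟨ interchange (g x z) (- h x z) (pathSum p g) (- pathSum p h) ⟩
    (g x z + pathSum p g) + (- h x z - pathSum p h)
      ≈⟨ +-congˡ (-‿+-comm (h x z) (pathSum p h)) ⟩
    (g x z + pathSum p g) - (h x z + pathSum p h) ∎

  pathSum-telescopes : ∀ (φ : Fin size → Carrier) {x y} (p : HPath x y) →
                       pathSum p (λ u v → φ v - φ u) ≈ φ y - φ x
  pathSum-telescopes φ {x} []                  = sym (-‿inverseʳ (φ x))
  pathSum-telescopes φ {x} {y} (_∷_ {x} {z} _ p) = begin
    (φ z - φ x) + pathSum p (λ u v → φ v - φ u)  ≈⟨ +-congˡ (pathSum-telescopes φ p) ⟩
    (φ z - φ x) + (φ y - φ z)                    ≈⟨ +-comm _ _ ⟩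
    (φ y - φ z) + (φ z - φ x)                    ≈⟨ +-minus-telescope (φ y) (φ z) (φ x) ⟩
    φ y - φ x                                    ∎

  transitive⇒pathSum : ∀ {f} → IsTransitive R P f → ∀ {x y} (p : HPath x y) → f x y ≈ pathSum p f
  transitive⇒pathSum tr {x} []                  = x+x≈x⇒x≈0 _ (sym (tr x x x ≼-refl ≼-refl))
  transitive⇒pathSum tr {x} (_∷_ {x} {z} x⋖z p) =
    trans (tr x z _ (⋖⇒≼ x⋖z) (path⇒≼ p)) (+-congˡ (transitive⇒pathSum tr p))

  potential⇒transitive : ∀ f → IsPotential R P f → IsTransitive R P f
  potential⇒transitive f (φ , f≈) x y z x≼y y≼z = begin
    f x z                      ≈⟨ f≈ x z (≼-trans x≼y y≼z) ⟩
    φ z - φ x                  ≈⟨ +-minus-telescope (φ z) (φ y) (φ x) ⟨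
    (φ z - φ y) + (φ y - φ x)  ≈⟨ +-comm _ _ ⟩
    (φ y - φ x) + (φ z - φ y)  ≈⟨ +-cong (f≈ x y x≼y) (f≈ y z y≼z) ⟨
    f x y + f y z              ∎

  transitive-coverPotential⇒potential : ∀ {f} → IsTransitive R P f → (φ : Fin size → Carrier) →
                                        (∀ {a b} → a ⋖ b → f a b ≈ φ b - φ a) → IsPotential R P f
  transitive-coverPotential⇒potential {f} tr φ f≈ = φ , λ x y x≼y → let p = saturatedChain x≼y in begin
    f x y                          ≈⟨ transitive⇒pathSum tr p ⟩
    pathSum p f                    ≈⟨ pathSum-cong p f≈ ⟩
    pathSum p (λ u v → φ v - φ u)  ≈⟨ pathSum-telescopes φ p ⟩
    φ y - φ x                      ∎

  Consistent : PairFunction → Set ℓ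
  Consistent g = ∀ {x y} (p q : HPath x y) → pathSum p g ≈ pathSum q g

  module _ (g : PairFunction) (consistent : Consistent g) where

    private
      extension : PairFunction
      extension x y with x ≼? y
      ... | yes x≼y = pathSum (saturatedChain x≼y) g
      ... | no _    = 0#

      extension-pathSum : ∀ {x y} (p : HPath x y) → extension x y ≈ pathSum p g
      extension-pathSum {x} {y} p with x ≼? y
      ... | yes x≼y = consistent (saturatedChain x≼y) p
      ... | no x⋠y  = ⊥-elim (x⋠y (path⇒≼ p))

      extension-transitive : IsTransitive R P extension
      extension-transitive x y z x≼y y≼z = begin
        extension x z                 ≈⟨ extension-pathSum (p ++ₚ q) ⟩
        pathSum (p ++ₚ q) g           ≈⟨ pathSum-++ p q g ⟩
        pathSum p g + pathSum q g     ≈⟨ +-cong (extension-pathSum p) (extension-pathSum q) ⟨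
        extension x y + extension y z ∎
        where
        p = saturatedChain x≼y
        q = saturatedChain y≼z

    consistent⇒transitiveExtension : ∃ λ f → IsTransitive R P f × (∀ {a b} → a ⋖ b → f a b ≈ g a b)
    consistent⇒transitiveExtension = extension , extension-transitive ,
      λ a⋖b → trans (extension-pathSum (a⋖b ∷ [])) (+-identityʳ _)

module SpanningForest (P : FinitePoset) where

  open FinitePoset P
  open Counting

  Pair : Set
  Pair = Fin size × Fin size

  record Forest : Set where
    constructor forest
    field
      label : Fin size → Fin size
      tree  : List Pair
      other : List Pair

  open Forest public

  merge : (Fin size → Fin size) → Fin size → Fin size → Fin size → Fin size
  merge l a b x with l x ≟ l b
  ... | yes _ = l a
  ... | no _  = l x

  merge-≡ : ∀ l a b {x} → l x ≡ l b → merge l a b x ≡ l a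
  merge-≡ l a b {x} lx≡lb with l x ≟ l b
  ... | yes _     = ≡.refl
  ... | no lx≢lb = ⊥-elim (lx≢lb lx≡lb)

  merge-≢ : ∀ l a b {x} → l x ≢ l b → merge l a b x ≡ l x
  merge-≢ l a b {x} lx≢lb with l x ≟ l b
  ... | yes lx≡lb = ⊥-elim (lx≢lb lx≡lb)
  ... | no _      = ≡.refl

  insert : Pair → Forest → Forest
  insert (a , b) F with label F a ≟ label F b
  ... | yes _ = forest (label F) (tree F) ((a , b) ∷ other F)
  ... | no _  = forest (merge (label F) a b) ((a , b) ∷ tree F) (other F)

  kruskal : List Pair → Forest
  kruskal = foldr insert (forest id [] [])

  length-tree+other : ∀ es → length (tree (kruskal es)) ℕ.+ length (other (kruskal es)) ≡ length es
  length-tree+other []             = ≡.refl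
  length-tree+other ((a , b) ∷ es) with label (kruskal es) a ≟ label (kruskal es) b
  ... | yes _ = ≡.trans (ℕ.+-suc _ _) (≡.cong suc (length-tree+other es))
  ... | no _  = ≡.cong suc (length-tree+other es)

  merge-idempotent : ∀ l a b → l a ≢ l b → (∀ x → l (l x) ≡ l x) →
                     ∀ x → merge l a b (merge l a b x) ≡ merge l a b x
  merge-idempotent l a b la≢lb idempotent x with l x ≟ l b
  ... | yes _    = ≡.trans (merge-≢ l a b (la≢lb ∘ ≡.trans (≡.sym (idempotent a)))) (idempotent a)
  ... | no lx≢lb = ≡.trans (merge-≢ l a b (lx≢lb ∘ ≡.trans (≡.sym (idempotent x)))) (idempotent x)

  label-idempotent : ∀ es x → label (kruskal es) (label (kruskal es) x) ≡ label (kruskal es) x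
  label-idempotent []             x = ≡.refl
  label-idempotent ((a , b) ∷ es) with label (kruskal es) a ≟ label (kruskal es) b
  ... | yes _    = label-idempotent es
  ... | no la≢lb = merge-idempotent (label (kruskal es)) a b la≢lb (label-idempotent es)

  merge-resp : ∀ l a b {u v} → l u ≡ l v → merge l a b u ≡ merge l a b v
  merge-resp l a b {u} {v} lu≡lv with l u ≟ l b
  ... | yes lu≡lb = ≡.sym (merge-≡ l a b (≡.trans (≡.sym lu≡lv) lu≡lb))
  ... | no lu≢lb  = ≡.trans lu≡lv (≡.sym (merge-≢ l a b (lu≢lb ∘ ≡.trans lu≡lv)))

  label-endpoints : ∀ es {u v} → (u , v) ∈ es → label (kruskal es) u ≡ label (kruskal es) v
  label-endpoints ((a , b) ∷ es) uv∈ with label (kruskal es) a ≟ label (kruskal es) b | uv∈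
  ... | yes la≡lb | here ≡.refl = la≡lb
  ... | yes _     | there uv∈es = label-endpoints es uv∈es
  ... | no la≢lb  | here ≡.refl = ≡.trans (merge-≢ (label (kruskal es)) a b la≢lb)
                                         (≡.sym (merge-≡ (label (kruskal es)) a b ≡.refl))
  ... | no _      | there uv∈es = merge-resp (label (kruskal es)) a b (label-endpoints es uv∈es)

  tree⊆ : ∀ es {e} → e ∈ tree (kruskal es) → e ∈ es
  tree⊆ ((a , b) ∷ es) e∈tree with label (kruskal es) a ≟ label (kruskal es) b | e∈tree
  ... | yes _ | e∈         = there (tree⊆ es e∈)
  ... | no _  | here e≡ab  = here e≡ab
  ... | no _  | there e∈   = there (tree⊆ es e∈)

  other⊆ : ∀ es {e} → e ∈ other (kruskal es) → e ∈ es
  other⊆ ((a , b) ∷ es) e∈other with label (kruskal es) a ≟ label (kruskal es) b | e∈other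
  ... | yes _ | here e≡ab  = here e≡ab
  ... | yes _ | there e∈   = there (other⊆ es e∈)
  ... | no _  | e∈         = there (other⊆ es e∈)

  tree⊎other : ∀ es {e} → e ∈ es → e ∈ tree (kruskal es) ⊎ e ∈ other (kruskal es)
  tree⊎other ((a , b) ∷ es) e∈ with label (kruskal es) a ≟ label (kruskal es) b | e∈
  ... | yes _ | here e≡ab = inj₂ (here e≡ab)
  ... | no _  | here e≡ab = inj₁ (here e≡ab)
  ... | yes _ | there e∈es with tree⊎other es e∈es
  ...   | inj₁ e∈tree  = inj₁ e∈tree
  ...   | inj₂ e∈other = inj₂ (there e∈other)
  tree⊎other ((a , b) ∷ es) e∈ | no _ | there e∈es with tree⊎other es e∈es
  ...   | inj₁ e∈tree  = inj₁ (there e∈tree)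
  ...   | inj₂ e∈other = inj₂ e∈other

  other-unique : ∀ {es} → Unique es → Unique (other (kruskal es))
  other-unique []                                    = []
  other-unique {(a , b) ∷ es} (fresh ∷ unique) with label (kruskal es) a ≟ label (kruskal es) b
  ... | yes _ = All.tabulate (All.lookup fresh ∘ other⊆ es) ∷ other-unique unique
  ... | no _  = other-unique unique

  tree-other-disjoint : ∀ {es} → Unique es → ∀ {e} → e ∈ other (kruskal es) → e ∉ tree (kruskal es)
  tree-other-disjoint {(a , b) ∷ es} (fresh ∷ unique) e∈other e∈tree
    with label (kruskal es) a ≟ label (kruskal es) b | e∈other | e∈tree
  ... | yes _ | here ≡.refl | e∈        = All.lookup fresh (tree⊆ es e∈) ≡.refl
  ... | yes _ | there e∈    | e∈′       = tree-other-disjoint unique e∈ e∈′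
  ... | no _  | e∈          | here ≡.refl = All.lookup fresh (other⊆ es e∈) ≡.refl
  ... | no _  | e∈          | there e∈′ = tree-other-disjoint unique e∈ e∈′

  TreeEdge : Forest → Fin size → Fin size → Set
  TreeEdge F a b = (a , b) ∈ tree F

  label-treeConnected : ∀ es x → EqClosure (TreeEdge (kruskal es)) x (label (kruskal es) x)
  label-treeConnected []             x = EqClosure.reflexive _
  label-treeConnected ((a , b) ∷ es) x with label (kruskal es) a ≟ label (kruskal es) b
  ... | yes _ = label-treeConnected es x
  ... | no _ with label (kruskal es) x ≟ label (kruskal es) b
  ...   | no _      = EqClosure.map there (label-treeConnected es x)
  ...   | yes lx≡lb = begin
    x                      ≈⟨ old x ⟩
    label (kruskal es) x   ≡⟨ lx≡lb ⟩
    label (kruskal es) b   ≈⟨ EqClosure.symmetric _ (old b) ⟩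
    b                      ≈⟨ EqClosure.symmetric _ (EqClosure.return (here ≡.refl)) ⟩
    a                      ≈⟨ old a ⟩
    label (kruskal es) a   ∎
    where
    Edge′ = λ u v → (u , v) ∈ ((a , b) ∷ tree (kruskal es))
    open import Relation.Binary.Reasoning.Setoid (EqClosure.setoid Edge′)
    old : ∀ y → EqClosure Edge′ y (label (kruskal es) y)
    old y = EqClosure.map there (label-treeConnected es y)

  roots : Forest → ℕ
  roots F = count (λ r → label F r ≟ r)

  roots-merge : ∀ l a b → l a ≢ l b → (∀ x → l (l x) ≡ l x) →
                count (λ r → l r ≟ r) ≡ suc (count (λ r → merge l a b r ≟ r))
  roots-merge l a b la≢lb idempotent =
    count-remove (λ r → l r ≟ r) (λ r → merge l a b r ≟ r) (l b) (idempotent b) lb-not-root new⊆old kept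
    where
    lb-not-root : merge l a b (l b) ≢ l b
    lb-not-root eq = la≢lb (≡.trans (≡.sym (merge-≡ l a b (idempotent b))) eq)
    new⊆old : ∀ {r} → merge l a b r ≡ r → l r ≡ r
    new⊆old {r} eq with l r ≟ l b
    ... | yes _ = ≡.trans (≡.cong l (≡.sym eq)) (≡.trans (idempotent a) eq)
    ... | no _  = eq
    kept : ∀ {r} → l r ≡ r → r ≢ l b → merge l a b r ≡ r
    kept {r} lr≡r r≢lb = ≡.trans (merge-≢ l a b (r≢lb ∘ ≡.trans (≡.sym lr≡r))) lr≡r

  length-tree+roots : ∀ es → length (tree (kruskal es)) ℕ.+ roots (kruskal es) ≡ size
  length-tree+roots []             = count-all (λ r → r ≟ r) (λ _ → ≡.refl)
  length-tree+roots ((a , b) ∷ es) with label (kruskal es) a ≟ label (kruskal es) b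
  ... | yes _    = length-tree+roots es
  ... | no la≢lb = begin
    suc (length (tree (kruskal es)) ℕ.+ roots′)
      ≡⟨ ℕ.+-suc _ roots′ ⟨
    length (tree (kruskal es)) ℕ.+ suc roots′
      ≡⟨ ≡.cong (length (tree (kruskal es)) ℕ.+_) (roots-merge _ a b la≢lb (label-idempotent es)) ⟨
    length (tree (kruskal es)) ℕ.+ roots (kruskal es)
      ≡⟨ length-tree+roots es ⟩
    size ∎
    where
    open ≡.≡-Reasoning
    roots′ = count (λ r → merge (label (kruskal es)) a b r ≟ r)

module ForestPotentials {c ℓ} (R : CommutativeRing c ℓ) (P : FinitePoset) where

  open FinitePoset P
  open SpanningForest P
  open CommutativeRing R hiding (zero)
  open RingDifferences R
  open import Algebra.Properties.Ring ring using (xyx⁻¹≈y)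
  open import Algebra.Properties.CommutativeSemigroup +-commutativeSemigroup using (xy∙z≈xz∙y)
  open import Relation.Binary.Reasoning.Setoid setoid

  -- A new tree edge (a, b) joins the class of b to that of a: shifting φ by Δ on the class of b
  -- corrects it on (a, b), while every older tree edge lies within a single class.
  tree-potential : ∀ es (g : Fin size → Fin size → Carrier) →
                   ∃ λ (φ : Fin size → Carrier) → ∀ {a b} → (a , b) ∈ tree (kruskal es) → g a b ≈ φ b - φ a
  tree-potential []             g = (λ _ → 0#) , λ ()
  tree-potential ((a , b) ∷ es) g with label (kruskal es) a ≟ label (kruskal es) b
  ... | yes _    = tree-potential es g
  ... | no la≢lb = φ′ , potential′
    where
    l = label (kruskal es)
    φ = proj₁ (tree-potential es g)
    Δ = g a b - (φ b - φ a)
    φ′ : Fin size → Carrier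
    φ′ x with l x ≟ l b
    ... | yes _ = φ x + Δ
    ... | no _  = φ x
    φ′-shifted : ∀ {x} → l x ≡ l b → φ′ x ≈ φ x + Δ
    φ′-shifted {x} lx≡lb with l x ≟ l b
    ... | yes _    = refl
    ... | no lx≢lb = ⊥-elim (lx≢lb lx≡lb)
    φ′-kept : ∀ {x} → l x ≢ l b → φ′ x ≈ φ x
    φ′-kept {x} lx≢lb with l x ≟ l b
    ... | yes lx≡lb = ⊥-elim (lx≢lb lx≡lb)
    ... | no _      = refl
    potential′ : ∀ {u v} → (u , v) ∈ ((a , b) ∷ tree (kruskal es)) → g u v ≈ φ′ v - φ′ u
    potential′ (here ≡.refl) = sym (begin
      φ′ b - φ′ a                      ≈⟨ +-cong (φ′-shifted ≡.refl) (-‿cong (φ′-kept la≢lb)) ⟩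
      (φ b + Δ) - φ a                  ≈⟨ xy∙z≈xz∙y (φ b) Δ (- φ a) ⟩
      (φ b - φ a) + Δ                  ≈⟨ +-assoc (φ b - φ a) (g a b) _ ⟨
      (φ b - φ a) + g a b - (φ b - φ a) ≈⟨ xyx⁻¹≈y (φ b - φ a) (g a b) ⟩
      g a b ∎)
    potential′ {u} {v} (there uv∈tree) =
      trans (proj₂ (tree-potential es g) uv∈tree) (sym (unchanged (l u ≟ l b)))
      where
      lu≡lv = label-endpoints es (tree⊆ es uv∈tree)
      unchanged : Dec (l u ≡ l b) → φ′ v - φ′ u ≈ φ v - φ u
      unchanged (yes lu≡lb) = begin
        φ′ v - φ′ u
          ≈⟨ +-cong (φ′-shifted (≡.trans (≡.sym lu≡lv) lu≡lb)) (-‿cong (φ′-shifted lu≡lb)) ⟩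
        (φ v + Δ) - (φ u + Δ)
          ≈⟨ [x+z]-[y+z]≈x-y (φ v) (φ u) Δ ⟩
        φ v - φ u ∎
      unchanged (no lu≢lb) = +-cong (φ′-kept (lu≢lb ∘ ≡.trans lu≡lv)) (-‿cong (φ′-kept lu≢lb))

  treeConstant⇒labelConstant : ∀ es (φ : Fin size → Carrier) →
                               (∀ {a b} → (a , b) ∈ tree (kruskal es) → φ a ≈ φ b) →
                               ∀ x → φ x ≈ φ (label (kruskal es) x)
  treeConstant⇒labelConstant es φ constant x =
    EqClosure.gfold isEquivalence φ constant (label-treeConnected es x)

lookup-injective : ∀ {A : Set} {xs : List A} → Unique xs → ∀ i j → lookup xs i ≡ lookup xs j → i ≡ j
lookup-injective (_ ∷ _)           zero    zero    _  = ≡.refl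
lookup-injective {xs = _ ∷ xs} (fresh ∷ _) zero    (suc j) eq = ⊥-elim (All.lookup fresh (∈-lookup j) eq)
lookup-injective {xs = _ ∷ xs} (fresh ∷ _) (suc i) zero    eq = ⊥-elim (All.lookup fresh (∈-lookup i) (≡.sym eq))
lookup-injective (_ ∷ unique)     (suc i) (suc j) eq = ≡.cong suc (lookup-injective unique i j eq)

module HasseForest (P : FinitePoset) where

  open FinitePoset P
  open SpanningForest P

  covers : List Pair
  covers = filter (λ e → proj₁ e ⋖? proj₂ e) (cartesianProduct (allFin size) (allFin size))

  covers-sound : ∀ {e} → e ∈ covers → proj₁ e ⋖ proj₂ e
  covers-sound = All.lookup (all-filter _ (cartesianProduct (allFin size) (allFin size)))

  covers-complete : ∀ {a b} → a ⋖ b → (a , b) ∈ covers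
  covers-complete = ∈-filter⁺ (λ e → proj₁ e ⋖? proj₂ e) (∈-cartesianProduct⁺ (∈-allFin _) (∈-allFin _))

  covers-unique : Unique covers
  covers-unique = Unique.filter⁺ _ (Unique.cartesianProduct⁺ (Unique.allFin⁺ size) (Unique.allFin⁺ size))

  spanningForest : Forest
  spanningForest = kruskal covers

  m : ℕ
  m = length (other spanningForest)

  nonTree : Fin m → Pair
  nonTree = lookup (other spanningForest)

  src tgt : Fin m → Fin size
  src = proj₁ ∘ nonTree
  tgt = proj₂ ∘ nonTree

  nonTree-⋖ : ∀ k → src k ⋖ tgt k
  nonTree-⋖ k = covers-sound (other⊆ covers (∈-lookup k))

  nonTreeEdge : Fin m → Edge
  nonTreeEdge k = src k , tgt k , nonTree-⋖ k

  nonTree-injective : ∀ j k → nonTree j ≡ nonTree k → j ≡ k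
  nonTree-injective = lookup-injective (other-unique covers-unique)

  nonTree∉tree : ∀ k → nonTree k ∉ tree spanningForest
  nonTree∉tree k = tree-other-disjoint covers-unique (∈-lookup k)

  cover⇒tree⊎nonTree : ∀ {a b} → a ⋖ b → (a , b) ∈ tree spanningForest ⊎ ∃ λ k → nonTree k ≡ (a , b)
  cover⇒tree⊎nonTree a⋖b with tree⊎other covers (covers-complete a⋖b)
  ... | inj₁ ab∈tree  = inj₁ ab∈tree
  ... | inj₂ ab∈other = inj₂ (Any.index ab∈other , ≡.sym (lookup-index ab∈other))

  tree-⋖ : ∀ {a b} → (a , b) ∈ tree spanningForest → a ⋖ b
  tree-⋖ = covers-sound ∘ tree⊆ covers

  label-resp-connected : ∀ {x y} → Connected x y → label spanningForest x ≡ label spanningForest y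
  label-resp-connected =
    EqClosure.gfold ≡.isEquivalence (label spanningForest) (label-endpoints covers ∘ covers-complete)

  connected-label : ∀ x → Connected x (label spanningForest x)
  connected-label x = EqClosure.map tree-⋖ (label-treeConnected covers x)

  module _ {C : ℕ} (comp : Fin size → Fin C) (comp-surjective : Surjective _≡_ _≡_ comp)
           (comp-connected : ∀ x y → (comp x ≡ comp y) ⇔ Connected x y) where

    roots≡components : roots spanningForest ≡ C
    roots≡components = Counting.count-bijection (λ r → label spanningForest r ≟ r) comp injective surjective
      where
      injective : ∀ {x y} → label spanningForest x ≡ x → label spanningForest y ≡ y → comp x ≡ comp y → x ≡ y
      injective {x} {y} x-root y-root eq =
        ≡.trans (≡.sym x-root) (≡.trans (label-resp-connected (Equivalence.to (comp-connected x y) eq)) y-root)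
      surjective : ∀ k → ∃ λ x → label spanningForest x ≡ x × comp x ≡ k
      surjective k = label spanningForest x , label-idempotent covers x ,
        ≡.trans (Equivalence.from (comp-connected (label spanningForest x) x) (EqClosure.symmetric _ (connected-label x)))
                (proj₂ (comp-surjective k) ≡.refl)
        where x = proj₁ (comp-surjective k)

    size≡tree+components : size ≡ length (tree spanningForest) ℕ.+ C
    size≡tree+components =
      ≡.trans (≡.sym (length-tree+roots covers)) (≡.cong (length (tree spanningForest) ℕ.+_) roots≡components)

  E≡tree+nonTree : E ≡ length (tree spanningForest) ℕ.+ m
  E≡tree+nonTree = ≡.sym (length-tree+other covers)

module ConsistencyMatrix {c ℓ} (R : CommutativeRing c ℓ) (P : FinitePoset) where

  open FinitePoset P
  open HasseDiagram P
  open TransitiveFunctions R P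
  open SpanningForest P
  open ForestPotentials R P
  open HasseForest P
  open LinearAlgebra R
  open RingDifferences R
  open CommutativeRing R hiding (zero)
  open import Algebra.Properties.Ring ring using (x∙y⁻¹≈ε⇒x≈y; [y-z]x≈yx-zx)
  open import Relation.Binary.Reasoning.Setoid setoid

  edgeIndicator : Fin size → Fin size → PairFunction
  edgeIndicator a b u v = if does (u ≟ a) then (if does (v ≟ b) then 1# else 0#) else 0#

  edgeIndicator-on : ∀ a b → edgeIndicator a b a b ≈ 1#
  edgeIndicator-on a b with a ≟ a | b ≟ b
  ... | yes _   | yes _   = refl
  ... | no a≢a | _       = ⊥-elim (a≢a ≡.refl)
  ... | yes _   | no b≢b = ⊥-elim (b≢b ≡.refl)

  edgeIndicator-off : ∀ {a b u v} → (u , v) ≢ (a , b) → edgeIndicator a b u v ≈ 0#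
  edgeIndicator-off {a} {b} {u} {v} uv≢ab with u ≟ a | v ≟ b
  ... | yes ≡.refl | yes ≡.refl = ⊥-elim (uv≢ab ≡.refl)
  ... | yes _      | no _       = refl
  ... | no _       | _          = refl

  coeff≡pathSum : ∀ {x y} (p : HPath x y) a b → coeff R P p a b ≡ pathSum p (edgeIndicator a b)
  coeff≡pathSum []                   a b = ≡.refl
  coeff≡pathSum (_∷_ {x} {z} _ p) a b = ≡.cong (edgeIndicator a b x z +_) (coeff≡pathSum p a b)

  A : ParallelPath → Fin m → Carrier
  A row k = 𝓜 R P row (nonTreeEdge k)

  coordinates : ∀ {x y} → HPath x y → Vector Carrier m
  coordinates p k = coeff R P p (src k) (tgt k)

  restrict : PairFunction → Vector Carrier m
  restrict h k = h (src k) (tgt k)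

  extendByZero : Vector Carrier m → PairFunction
  extendByZero w u v = sum (λ k → edgeIndicator (src k) (tgt k) u v * w k)

  extendByZero-nonTree : ∀ w j → extendByZero w (src j) (tgt j) ≈ w j
  extendByZero-nonTree w j = begin
    extendByZero w (src j) (tgt j)                  ≈⟨ sum-delta _ j off ⟩
    edgeIndicator (src j) (tgt j) (src j) (tgt j) * w j ≈⟨ *-congʳ (edgeIndicator-on (src j) (tgt j)) ⟩
    1# * w j                                        ≈⟨ *-identityˡ (w j) ⟩
    w j                                             ∎
    where
    off : ∀ k → k ≢ j → edgeIndicator (src k) (tgt k) (src j) (tgt j) * w k ≈ 0#
    off k k≢j = trans (*-congʳ (edgeIndicator-off (k≢j ∘ ≡.sym ∘ nonTree-injective j k))) (zeroˡ (w k))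

  extendByZero-tree : ∀ w {u v} → (u , v) ∈ tree spanningForest → extendByZero w u v ≈ 0#
  extendByZero-tree w uv∈tree = sum-zero λ k →
    trans (*-congʳ (edgeIndicator-off λ uv≡k → nonTree∉tree k (≡.subst (_∈ tree spanningForest) uv≡k uv∈tree)))
          (zeroˡ (w k))

  VanishesOnTree : PairFunction → Set ℓ
  VanishesOnTree h = ∀ {u v} → (u , v) ∈ tree spanningForest → h u v ≈ 0#

  module _ {h : PairFunction} (vanishes : VanishesOnTree h) where

    vanishesOnTree-covers : ∀ {u v} → u ⋖ v → h u v ≈ extendByZero (restrict h) u v
    vanishesOnTree-covers u⋖v with cover⇒tree⊎nonTree u⋖v
    ... | inj₁ uv∈tree       = trans (vanishes uv∈tree) (sym (extendByZero-tree (restrict h) uv∈tree))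
    ... | inj₂ (k , ≡.refl) = sym (extendByZero-nonTree (restrict h) k)

    pathSum-coordinates : ∀ {x y} (p : HPath x y) → pathSum p h ≈ sum (λ k → coordinates p k * restrict h k)
    pathSum-coordinates [] = sym (sum-zero (λ k → zeroˡ (restrict h k)))
    pathSum-coordinates (_∷_ {x} {z} x⋖z p) = begin
      h x z + pathSum p h
        ≈⟨ +-cong (vanishesOnTree-covers x⋖z) (pathSum-coordinates p) ⟩
      sum (λ k → e k * restrict h k) + sum (λ k → coordinates p k * restrict h k)
        ≈⟨ ∑-distrib-+ (λ k → e k * restrict h k) (λ k → coordinates p k * restrict h k) ⟨
      sum (λ k → e k * restrict h k + coordinates p k * restrict h k)
        ≈⟨ sum-cong-≋ (λ k → distribʳ (restrict h k) (e k) (coordinates p k)) ⟨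
      sum (λ k → coordinates (x⋖z ∷ p) k * restrict h k) ∎
      where
      e : Vector Carrier m
      e k = edgeIndicator (src k) (tgt k) x z

    parallelPaths-coordinates : ∀ {x y} (p q : HPath x y) →
                                pathSum p h - pathSum q h ≈ sum (λ k → A (x , y , p , q) k * restrict h k)
    parallelPaths-coordinates p q = begin
      pathSum p h - pathSum q h
        ≈⟨ +-cong (pathSum-coordinates p) (-‿cong (pathSum-coordinates q)) ⟩
      sum (λ k → coordinates p k * restrict h k) - sum (λ k → coordinates q k * restrict h k)
        ≈⟨ ∑-distrib-− (λ k → coordinates p k * restrict h k) (λ k → coordinates q k * restrict h k) ⟨
      sum (λ k → coordinates p k * restrict h k - coordinates q k * restrict h k)
        ≈⟨ sum-cong-≋ (λ k → [y-z]x≈yx-zx (restrict h k) (coordinates p k) (coordinates q k)) ⟨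
      sum (λ k → (coordinates p k - coordinates q k) * restrict h k) ∎

  subtractPotential : PairFunction → (Fin size → Carrier) → PairFunction
  subtractPotential g φ u v = g u v - (φ v - φ u)

  parallelPaths-subtractPotential : ∀ g φ {x y} (p q : HPath x y) →
    pathSum p (subtractPotential g φ) - pathSum q (subtractPotential g φ) ≈ pathSum p g - pathSum q g
  parallelPaths-subtractPotential g φ {x} {y} p q =
    trans (+-cong (subtracted p) (-‿cong (subtracted q))) ([x+z]-[y+z]≈x-y _ _ (- (φ y - φ x)))
    where
    subtracted : (p : HPath x y) → pathSum p (subtractPotential g φ) ≈ pathSum p g - (φ y - φ x)
    subtracted p = trans (pathSum-− p g (λ u v → φ v - φ u)) (+-congˡ (-‿cong (pathSum-telescopes φ p)))

  treePotential : PairFunction → Fin size → Carrier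
  treePotential g = proj₁ (tree-potential covers g)

  subtractTreePotential-vanishes : ∀ g → VanishesOnTree (subtractPotential g (treePotential g))
  subtractTreePotential-vanishes g uv∈tree =
    trans (+-congʳ (proj₂ (tree-potential covers g) uv∈tree)) (-‿inverseʳ _)

  W : Edge → Vector Carrier m
  W (a , b , _) = restrict (subtractPotential (edgeIndicator a b) (treePotential (edgeIndicator a b)))

  𝓜-columnsInSpan : ∀ row e → 𝓜 R P row e ≈ sum (λ k → W e k * A row k)
  𝓜-columnsInSpan row@(x , y , p , q) e@(a , b , _) = begin
    coeff R P p a b - coeff R P q a b
      ≡⟨ ≡.cong₂ _-_ (coeff≡pathSum p a b) (coeff≡pathSum q a b) ⟩
    pathSum p g - pathSum q g
      ≈⟨ parallelPaths-subtractPotential g (treePotential g) p q ⟨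
    pathSum p h - pathSum q h
      ≈⟨ parallelPaths-coordinates (subtractTreePotential-vanishes g) p q ⟩
    sum (λ k → A row k * restrict h k)
      ≈⟨ sum-cong-≋ (λ k → *-comm (A row k) (restrict h k)) ⟩
    sum (λ k → W e k * A row k) ∎
    where
    g = edgeIndicator a b
    h = subtractPotential g (treePotential g)

  potEqDer⇒trivialKernel : PotEqDer R P → HasTrivialKernel A
  potEqDer⇒trivialKernel (_ , der⇒pot) x Ax≈0 k = begin
    x k                         ≈⟨ extendByZero-nonTree x k ⟨
    g (src k) (tgt k)           ≈⟨ f≈g (nonTree-⋖ k) ⟨
    f (src k) (tgt k)           ≈⟨ f≈δφ (src k) (tgt k) (⋖⇒≼ (nonTree-⋖ k)) ⟩
    φ (tgt k) - φ (src k)       ≈⟨ +-congˡ (-‿cong (φ-constant-on-covers (nonTree-⋖ k))) ⟩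
    φ (tgt k) - φ (tgt k)       ≈⟨ -‿inverseʳ (φ (tgt k)) ⟩
    0#                          ∎
    where
    g = extendByZero x
    consistent : Consistent g
    consistent {x′} {y′} p q = x∙y⁻¹≈ε⇒x≈y _ _ (begin
      pathSum p g - pathSum q g
        ≈⟨ parallelPaths-coordinates (extendByZero-tree x) p q ⟩
      sum (λ j → A (x′ , y′ , p , q) j * restrict g j)
        ≈⟨ sum-cong-≋ (λ j → *-congˡ (extendByZero-nonTree x j)) ⟩
      sum (λ j → A (x′ , y′ , p , q) j * x j)
        ≈⟨ Ax≈0 (x′ , y′ , p , q) ⟩
      0# ∎)
    f = proj₁ (consistent⇒transitiveExtension g consistent)
    f≈g = proj₂ (proj₂ (consistent⇒transitiveExtension g consistent))
    φ = proj₁ (der⇒pot f (proj₁ (proj₂ (consistent⇒transitiveExtension g consistent))))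
    f≈δφ = proj₂ (der⇒pot f (proj₁ (proj₂ (consistent⇒transitiveExtension g consistent))))
    φ-constant-on-tree : ∀ {a b} → (a , b) ∈ tree spanningForest → φ a ≈ φ b
    φ-constant-on-tree {a} {b} ab∈tree = sym (x∙y⁻¹≈ε⇒x≈y _ _ (begin
      φ b - φ a   ≈⟨ f≈δφ a b (⋖⇒≼ (tree-⋖ ab∈tree)) ⟨
      f a b       ≈⟨ f≈g (tree-⋖ ab∈tree) ⟩
      g a b       ≈⟨ extendByZero-tree x ab∈tree ⟩
      0# ∎))
    φ-constant-on-covers : ∀ {a b} → a ⋖ b → φ a ≈ φ b
    φ-constant-on-covers {a} {b} a⋖b = begin
      φ a                    ≈⟨ treeConstant⇒labelConstant covers φ φ-constant-on-tree a ⟩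
      φ (label spanningForest a)      ≡⟨ ≡.cong φ (label-endpoints covers (covers-complete a⋖b)) ⟩
      φ (label spanningForest b)      ≈⟨ treeConstant⇒labelConstant covers φ φ-constant-on-tree b ⟨
      φ b                    ∎

  trivialKernel⇒potEqDer : HasTrivialKernel A → PotEqDer R P
  trivialKernel⇒potEqDer trivial = potential⇒transitive , der⇒pot
    where
    der⇒pot : ∀ f → IsTransitive R P f → IsPotential R P f
    der⇒pot f f-transitive = transitive-coverPotential⇒potential f-transitive φ f≈δφ
      where
      φ = treePotential f
      h = subtractPotential f φ
      h-vanishes = subtractTreePotential-vanishes f
      h-inKernel : InKernel A (restrict h)
      h-inKernel (x , y , p , q) = begin
        sum (λ k → A (x , y , p , q) k * restrict h k)
          ≈⟨ parallelPaths-coordinates h-vanishes p q ⟨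
        pathSum p h - pathSum q h
          ≈⟨ parallelPaths-subtractPotential f φ p q ⟩
        pathSum p f - pathSum q f
          ≈⟨ +-cong (transitive⇒pathSum f-transitive p) (-‿cong (transitive⇒pathSum f-transitive q)) ⟨
        f x y - f x y
          ≈⟨ -‿inverseʳ (f x y) ⟩
        0# ∎
      f≈δφ : ∀ {a b} → a ⋖ b → f a b ≈ φ b - φ a
      f≈δφ {a} {b} a⋖b = x∙y⁻¹≈ε⇒x≈y _ _ (begin
        h a b
          ≈⟨ vanishesOnTree-covers h-vanishes a⋖b ⟩
        extendByZero (restrict h) a b
          ≈⟨ sum-zero (λ k → trans (*-congˡ (trivial (restrict h) h-inKernel k)) (zeroʳ _)) ⟩
        0# ∎)

  potEqDer⇔trivialKernel : PotEqDer R P ⇔ HasTrivialKernel A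
  potEqDer⇔trivialKernel = mk⇔ potEqDer⇒trivialKernel trivialKernel⇒potEqDer

open import Data.Integer using (+_; _-_; _⊖_)
import Data.Integer.Properties as ℤ
open import Algebra.Properties.AbelianGroup ℤ.+-0-abelianGroup using (∙-cancelˡ)

[+[m+n]]-[+n]≡+m : ∀ m n → (+ (m ℕ.+ n)) - (+ n) ≡ + m
[+[m+n]]-[+n]≡+m m n = begin
  (+ (m ℕ.+ n)) - (+ n)   ≡⟨ ℤ.[+m]-[+n]≡m⊖n (m ℕ.+ n) n ⟩
  (m ℕ.+ n) ⊖ n           ≡⟨ ℤ.⊖-≥ (ℕ.m≤n+m n m) ⟩
  + ((m ℕ.+ n) ℕ.∸ n)     ≡⟨ ≡.cong +_ (ℕ.m+n∸n≡m m n) ⟩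
  + m                     ∎
  where open ≡.≡-Reasoning

[+a]-[+b]≡[+a]-[+c]⇒b≡c : ∀ a {b c} → (+ a) - (+ b) ≡ (+ a) - (+ c) → b ≡ c
[+a]-[+b]≡[+a]-[+c]⇒b≡c a {b} {c} eq = ℤ.+-injective (ℤ.neg-injective (∙-cancelˡ (+ a) _ _ eq))

[+[t+m]]-[+ρ]≡[+[t+C]]-[+C]⇔ρ≡m : ∀ t m C ρ →
                                  ((+ (t ℕ.+ m)) - (+ ρ) ≡ (+ (t ℕ.+ C)) - (+ C)) ⇔ (ρ ≡ m)
[+[t+m]]-[+ρ]≡[+[t+C]]-[+C]⇔ρ≡m t m C ρ = mk⇔
  (λ eq → [+a]-[+b]≡[+a]-[+c]⇒b≡c (t ℕ.+ m)
             (≡.trans eq (≡.trans ([+[m+n]]-[+n]≡+m t C) (≡.sym ([+[m+n]]-[+n]≡+m t m)))))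
  (λ { ≡.refl → ≡.trans ([+[m+n]]-[+n]≡+m t m) (≡.sym ([+[m+n]]-[+n]≡+m t C)) })

mainTheorem3 : ∀ {c ℓ} (k : CommutativeRing c ℓ) (P : FinitePoset) →
    ¬ (CommutativeRing._≈_ k (CommutativeRing.1# k) (CommutativeRing.0# k)) →
    (C : ℕ) (comp : Fin (FinitePoset.size P) → Fin C) →
    Surjective _≡_ _≡_ comp →
    (∀ x y → (comp x ≡ comp y) ⇔ FinitePoset.Connected P x y) →
    (ρ : ℕ) → IsRank k (𝓜 k P) ρ →
    PotEqDer k P ⇔ ((+ FinitePoset.E P) - (+ ρ) ≡ (+ FinitePoset.V P) - (+ C))
mainTheorem3 k P 1≉0 C comp comp-surjective comp-connected ρ rank =
  potEqDer⇔trivialKernel ⟨ ⇔-trans ⟩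
  trivialKernel⇔minorAnnZero A ⟨ ⇔-trans ⟩
  ⇔-sym (minorAnnZero-columnSpan (𝓜 k P) nonTreeEdge W 𝓜-columnsInSpan) ⟨ ⇔-trans ⟩
  ⇔-sym (rank≡width⇔minorAnnZero (𝓜 k P) nonTreeEdge W 𝓜-columnsInSpan 1≉0 rank) ⟨ ⇔-trans ⟩
  ⇔-sym rank-equation
  where
  open FinitePoset P using (E; V)
  open HasseForest P
  open SpanningForest P using (tree)
  open ConsistencyMatrix k P
  open LinearAlgebra k
  rank-equation : ((+ E) - (+ ρ) ≡ (+ V) - (+ C)) ⇔ (ρ ≡ m)
  rank-equation = ≡.subst₂ (λ e v → ((+ e) - (+ ρ) ≡ (+ v) - (+ C)) ⇔ (ρ ≡ m))
    (≡.sym E≡tree+nonTree) (≡.sym (size≡tree+components comp comp-surjective comp-connected))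
    ([+[t+m]]-[+ρ]≡[+[t+C]]-[+C]⇔ρ≡m (length (tree spanningForest)) m C ρ)
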